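{- For every composition $\alpha$ and every $s\ge0$, \[ \mathfrak{S}_\alpha\,\mathfrak{S}_{1^s} = \sum_{\beta} \mathfrak{S}_\beta, \] where the sum runs over compositions $\beta\models|\alpha|+s$ such that $\alpha_i\le\beta_i\le\alpha_i+1$ for all $i\ge1$, with the convention that $\alpha_i=0$ for $i>\ell(\alpha)$ (and $\beta_i=0$ for $i>\ell(\beta)$).
   Context: Work over $\mathbb{Q}$. $\mathrm{NSym}$ is the free associative algebra on $H_1,H_2,\dots$ ($H_0=1$, $H_{ -r}=0$ for $r>0$), graded dual to $\mathrm{QSym}$ via $\langle H_{\alpha_1}\cdots H_{\alpha_k},M_\beta\rangle=\delta_{\alpha\beta}$ ($M_\beta$ monomial quasisymmetric functions), coproduct $\Delta(H_j)=\sum_iH_i\otimes H_{j-i}$. For $F\in\mathrm{QSym}$, $F^\perp$ satisfies $\langle F^\perp(H),G\rangle=\langle H,FG\rangle$; $F_{1^i}=M_{1^i}$. Let $\mathbb{B}_m=\sum_{i\ge0}(-1)^iH_{m+i}F_{1^i}^\perp$ and $\mathfrak{S}_\alpha=\mathbb{B}_{\alpha_1}\cdots\mathbb{B}_{\alpha_m}(1)$; $1^s$ denotes the composition $(1,\dots,1)$ with $s$ parts ($\mathfrak{S}_{1^0}=1$). -}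

module Defs where

open import Data.Bool using (Bool; true; false; _∧_; if_then_else_)
open import Data.Nat as ℕ using (ℕ; zero; suc; _<_; _≤ᵇ_; _≡ᵇ_)
open import Data.Integer using (+_)
open import Data.List using (List; []; _∷_; [_]; _++_; map; concatMap; foldr; replicate; upTo; length; filter; filterᵇ)
open import Data.Nat.ListAction using (sum)
open import Relation.Nullary using (yes; no)
open import Data.List.Properties using (≡-dec)
open import Data.List.Relation.Unary.All using (All)
open import Data.Rational as ℚ using (ℚ; 0ℚ; 1ℚ)
open import Data.Product using (_×_; _,_)
open import Relation.Binary.PropositionalEquality using (_≡_)

IsComposition : List ℕ → Set
IsComposition α = All (0 <_) α

∣_∣c : List ℕ → ℕ
∣ α ∣c = sum α

-- compositions of n+1, by the usual binary recursion
comps1 : ℕ → List (List ℕ)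
comps1 zero    = [ 1 ∷ [] ]
comps1 (suc n) = concatMap (λ c → (1 ∷ c) ∷ incHead c ∷ []) (comps1 n)
  where
  incHead : List ℕ → List ℕ
  incHead []      = []
  incHead (a ∷ c) = suc a ∷ c

compositions : ℕ → List (List ℕ)
compositions zero    = [ [] ]
compositions (suc n) = comps1 n

compositionsUpTo : ℕ → List (List ℕ)
compositionsUpTo n = concatMap compositions (upTo (suc n))

-- NSym over ℚ: finite formal ℚ-linear combinations of the basis
-- H_α = H_{α₁} ⋯ H_{α_k} (α a composition).

NSym : Set
NSym = List (ℚ × List ℕ)

oneN : NSym
oneN = (1ℚ , []) ∷ []

-- coefficient of H_γ, i.e. the pairing ⟨x , M_γ⟩
coeff : NSym → List ℕ → ℚ
coeff x γ = foldr (λ { (q , β) r → if isEq β then q ℚ.+ r else r }) 0ℚ x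
  where
  isEq : List ℕ → Bool
  isEq β with ≡-dec ℕ._≟_ β γ
  ... | yes _ = true
  ... | no  _ = false

infix 4 _≈N_
_≈N_ : NSym → NSym → Set
x ≈N y = ∀ γ → coeff x γ ≡ coeff y γ

scale : ℚ → NSym → NSym
scale c x = map (λ { (q , β) → (c ℚ.* q , β) }) x

sumN : List NSym → NSym
sumN = foldr _++_ []

infixl 7 _·N_
_·N_ : NSym → NSym → NSym
x ·N y = concatMap (λ { (p , α) → map (λ { (q , β) → (p ℚ.* q , α ++ β) }) y }) x

Hmul : ℕ → NSym → NSym
Hmul zero    x = x
Hmul (suc m) x = map (λ { (q , β) → (q , suc m ∷ β) }) x

-- QSym: product of monomial quasisymmetric functions (quasi-shuffle)
-- M_u M_v = Σ_{w ∈ qsh u v} M_w   (with multiplicity)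

qsh : List ℕ → List ℕ → List (List ℕ)
qsh []      v       = [ v ]
qsh (a ∷ u) []      = [ a ∷ u ]
qsh (a ∷ u) (b ∷ v) =
  map (a ∷_) (qsh u (b ∷ v)) ++ map (b ∷_) (qsh (a ∷ u) v) ++ map ((a ℕ.+ b) ∷_) (qsh u v)

countL : List ℕ → List (List ℕ) → ℕ
countL α ws = length (filter (λ w → ≡-dec ℕ._≟_ w α) ws)

fromℕq : ℕ → ℚ
fromℕq n = (+ n) ℚ./ 1

-- F_{1^i}^⊥ = M_{1^i}^⊥, defined by ⟨F^⊥(H), G⟩ = ⟨H, F G⟩:
-- ⟨M_{1^i}^⊥ H_α , M_γ⟩ = ⟨H_α , M_{1^i} M_γ⟩ = [M_α] (M_{1^i} M_γ).
-- Only γ with |γ| ≤ |α| can contribute (M_{1^i} M_γ is homogeneous of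
-- degree i + |γ|), so γ ranges over compositions of size ≤ |α|.

perpBasis : ℕ → List ℕ → NSym
perpBasis i α =
  map (λ γ → (fromℕq (countL α (qsh (replicate i 1) γ)) , γ)) (compositionsUpTo ∣ α ∣c)

perp1 : ℕ → NSym → NSym
perp1 i x = concatMap (λ { (q , α) → scale q (perpBasis i α) }) x

sgn : ℕ → ℚ
sgn zero    = 1ℚ
sgn (suc i) = ℚ.- sgn i

-- an upper bound for the degree of x (F_{1^i}^⊥ x = 0 for i above it)
degBound : NSym → ℕ
degBound x = sum (map (λ { (_ , α) → ∣ α ∣c }) x)

-- 𝔹_m = Σ_{i≥0} (-1)^i H_{m+i} F_{1^i}^⊥   (terms with i > degBound x vanish)
𝔹 : ℕ → NSym → NSym
𝔹 m x = sumN (map (λ i → scale (sgn i) (Hmul (m ℕ.+ i) (perp1 i x))) (upTo (suc (degBound x))))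

𝔖 : List ℕ → NSym
𝔖 α = foldr 𝔹 oneN α

admissibleᵇ : List ℕ → List ℕ → Bool
admissibleᵇ []      []      = true
admissibleᵇ []      (b ∷ β) = (b ≤ᵇ 1) ∧ admissibleᵇ [] β
admissibleᵇ (a ∷ α) []      = (a ≤ᵇ 0) ∧ admissibleᵇ α []
admissibleᵇ (a ∷ α) (b ∷ β) = (a ≤ᵇ b) ∧ (b ≤ᵇ suc a) ∧ admissibleᵇ α β

pieriIndex : List ℕ → ℕ → List (List ℕ)
pieriIndex α s = filterᵇ (admissibleᵇ α) (compositions (∣ α ∣c ℕ.+ s))

-- Work coefficientwise: x ∈ NSym is determined by its coefficients ⟨x , M_γ⟩ in the H-basis. The product
-- becomes convolution over deconcatenations γ = γ₁ γ₂, and F_{1^i}^⊥ = M_{1^i}^⊥ becomes a sum over the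
-- quasi-shuffles of 1^i with γ. Deconcatenation is multiplicative for the quasi-shuffle product, so every
-- M_u^⊥ obeys a Leibniz rule over the splittings of u. Since 𝔖_{1^s} = E_s has coefficient (−1)^(s − ℓ(γ))
-- at each γ ⊨ s, one finds M_{1u}^⊥ E_{s+1} = M_u^⊥ E_s, and the Leibniz rule then gives the commutation
-- relation (𝔹_m F) E_{s+1} = 𝔹_m (F E_{s+1}) + 𝔹_{m+1} (F E_s). Induction on α finishes the proof: the
-- admissible β for α₁ α₂ ⋯ are those for α₂ ⋯ prefixed by α₁ (with s) or by α₁ + 1 (with s − 1).

module Submission where

open import Defs
open import Data.Nat using (ℕ)
open import Data.List using (List; map; replicate)

open import Data.Bool using (Bool; true; false; T; T?)
open import Data.Bool.Properties using (T-∧)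
open import Data.Empty using (⊥-elim)
open import Data.List using ([]; _∷_; _++_; concatMap; filterᵇ; upTo; applyUpTo; length)
import Data.List.Properties as ListP
open import Data.List.Relation.Unary.All as All using (All; []; _∷_)
open import Data.List.Relation.Unary.All.Properties using (++⁺; map⁺; concat⁺)
open import Data.Nat as ℕ using (zero; suc)
import Data.Nat.Properties as ℕP
open import Algebra.Properties.CommutativeSemigroup ℕP.+-commutativeSemigroup using (interchange; x∙yz≈y∙xz)
open import Data.Nat.ListAction using (sum)
open import Data.Product using (_×_; _,_; proj₂)
open import Data.Rational using (ℚ; 0ℚ; 1ℚ; _+_; _*_; -_)
import Data.Rational.Properties as ℚP
open import Data.Rational.Solver using (module +-*-Solver)
open +-*-Solver using (solve; _:+_; _:*_; :-_; _:=_; con)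
open import Data.Unit using (tt)
open import Function using (_∘_; Equivalence)
open import Relation.Nullary using (yes; no; Dec)
open import Relation.Binary.PropositionalEquality
open ≡-Reasoning

private variable A B : Set

∑ : List A → (A → ℚ) → ℚ
∑ []       f = 0ℚ
∑ (x ∷ xs) f = f x + ∑ xs f

infix 5 ∑
syntax ∑ xs (λ x → e) = ∑[ x ← xs ] e

∑-++ : ∀ (xs ys : List A) f → ∑ (xs ++ ys) f ≡ ∑ xs f + ∑ ys f
∑-++ []       ys f = sym (ℚP.+-identityˡ _)
∑-++ (x ∷ xs) ys f = trans (cong (f x +_) (∑-++ xs ys f)) (sym (ℚP.+-assoc (f x) _ _))

∑-map : ∀ (g : A → B) xs f → ∑ (map g xs) f ≡ ∑ xs (f ∘ g)
∑-map g []       f = refl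
∑-map g (x ∷ xs) f = cong (f (g x) +_) (∑-map g xs f)

∑-cong : ∀ (xs : List A) {f g : A → ℚ} → (∀ x → f x ≡ g x) → ∑ xs f ≡ ∑ xs g
∑-cong []       e = refl
∑-cong (x ∷ xs) e = cong₂ _+_ (e x) (∑-cong xs e)

∑-cong-All : ∀ {xs : List A} {f g : A → ℚ} → All (λ x → f x ≡ g x) xs → ∑ xs f ≡ ∑ xs g
∑-cong-All []         = refl
∑-cong-All (px ∷ pxs) = cong₂ _+_ px (∑-cong-All pxs)

∑-concatMap : ∀ (g : A → List B) xs f → ∑ (concatMap g xs) f ≡ ∑[ x ← xs ] ∑ (g x) f
∑-concatMap g []       f = refl
∑-concatMap g (x ∷ xs) f = trans (∑-++ (g x) _ f) (cong (∑ (g x) f +_) (∑-concatMap g xs f))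

∑-zero : ∀ (xs : List A) {f : A → ℚ} → (∀ x → f x ≡ 0ℚ) → ∑ xs f ≡ 0ℚ
∑-zero []       e = refl
∑-zero (x ∷ xs) e = trans (cong₂ _+_ (e x) (∑-zero xs e)) (ℚP.+-identityˡ 0ℚ)

∑-+ : ∀ (xs : List A) f g → ∑[ x ← xs ] (f x + g x) ≡ ∑ xs f + ∑ xs g
∑-+ []       f g = sym (ℚP.+-identityˡ 0ℚ)
∑-+ (x ∷ xs) f g = trans (cong ((f x + g x) +_) (∑-+ xs f g))
  (solve 4 (λ a b c d → (a :+ b) :+ (c :+ d) := (a :+ c) :+ (b :+ d)) refl (f x) (g x) _ _)

∑∑-+ : ∀ (xs : List A) (ys : List B) (f g : A → B → ℚ) →
       ∑[ x ← xs ] ∑[ y ← ys ] (f x y + g x y) ≡ (∑[ x ← xs ] ∑ ys (f x)) + (∑[ x ← xs ] ∑ ys (g x))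
∑∑-+ xs ys f g = trans (∑-cong xs (λ x → ∑-+ ys (f x) (g x))) (∑-+ xs (λ x → ∑ ys (f x)) (λ x → ∑ ys (g x)))

∑-*ˡ : ∀ (xs : List A) c f → c * ∑ xs f ≡ ∑[ x ← xs ] c * f x
∑-*ˡ []       c f = ℚP.*-zeroʳ c
∑-*ˡ (x ∷ xs) c f = trans (ℚP.*-distribˡ-+ c (f x) _) (cong (c * f x +_) (∑-*ˡ xs c f))

∑-swap : ∀ (xs : List A) (ys : List B) (f : A → B → ℚ) →
         ∑[ x ← xs ] ∑ ys (f x) ≡ ∑[ y ← ys ] ∑[ x ← xs ] f x y
∑-swap []       ys f = sym (∑-zero ys (λ _ → refl))
∑-swap (x ∷ xs) ys f = trans (cong (∑ ys (f x) +_) (∑-swap xs ys f)) (sym (∑-+ ys (f x) _))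

∑*∑ : ∀ (xs : List A) (ys : List B) f g → ∑ xs f * ∑ ys g ≡ ∑[ x ← xs ] ∑[ y ← ys ] f x * g y
∑*∑ xs ys f g = begin
  ∑ xs f * ∑ ys g            ≡⟨ ℚP.*-comm _ (∑ ys g) ⟩
  ∑ ys g * ∑ xs f            ≡⟨ ∑-*ˡ xs (∑ ys g) f ⟩
  ∑[ x ← xs ] ∑ ys g * f x   ≡⟨ ∑-cong xs (λ x → trans (ℚP.*-comm _ (f x)) (∑-*ˡ ys (f x) g)) ⟩
  ∑[ x ← xs ] ∑[ y ← ys ] f x * g y ∎

δℕ : ℕ → ℕ → ℚ
δℕ zero    zero    = 1ℚ
δℕ zero    (suc _) = 0ℚ
δℕ (suc _) zero    = 0ℚ
δℕ (suc a) (suc b) = δℕ a b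

δ : List ℕ → List ℕ → ℚ
δ []      []      = 1ℚ
δ []      (_ ∷ _) = 0ℚ
δ (_ ∷ _) []      = 0ℚ
δ (a ∷ β) (b ∷ γ) = δℕ a b * δ β γ

δℕ-refl : ∀ a → δℕ a a ≡ 1ℚ
δℕ-refl zero    = refl
δℕ-refl (suc a) = δℕ-refl a

δ-refl : ∀ β → δ β β ≡ 1ℚ
δ-refl []      = refl
δ-refl (a ∷ β) = cong₂ _*_ (δℕ-refl a) (δ-refl β)

δℕ-≢ : ∀ a b → a ≢ b → δℕ a b ≡ 0ℚ
δℕ-≢ zero    zero    a≢b = ⊥-elim (a≢b refl)
δℕ-≢ zero    (suc b) a≢b = refl
δℕ-≢ (suc a) zero    a≢b = refl
δℕ-≢ (suc a) (suc b) a≢b = δℕ-≢ a b (a≢b ∘ cong suc)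

δ-≢ : ∀ β γ → β ≢ γ → δ β γ ≡ 0ℚ
δ-≢ []      []      β≢γ = ⊥-elim (β≢γ refl)
δ-≢ []      (_ ∷ _) β≢γ = refl
δ-≢ (_ ∷ _) []      β≢γ = refl
δ-≢ (a ∷ β) (b ∷ γ) β≢γ with a ℕ.≟ b
... | no a≢b   = trans (cong (_* δ β γ) (δℕ-≢ a b a≢b)) (ℚP.*-zeroˡ (δ β γ))
... | yes refl = trans (cong (δℕ a a *_) (δ-≢ β γ (β≢γ ∘ cong (a ∷_)))) (ℚP.*-zeroʳ (δℕ a a))

δℕ-sym : ∀ a b → δℕ a b ≡ δℕ b a
δℕ-sym zero    zero    = refl
δℕ-sym zero    (suc b) = refl
δℕ-sym (suc a) zero    = refl
δℕ-sym (suc a) (suc b) = δℕ-sym a b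

δ-sym : ∀ β γ → δ β γ ≡ δ γ β
δ-sym []      []      = refl
δ-sym []      (_ ∷ _) = refl
δ-sym (_ ∷ _) []      = refl
δ-sym (a ∷ β) (b ∷ γ) = cong₂ _*_ (δℕ-sym a b) (δ-sym β γ)

𝟙 : Bool → ℚ
𝟙 true  = 1ℚ
𝟙 false = 0ℚ

𝟙-T : ∀ {b} → T b → 𝟙 b ≡ 1ℚ
𝟙-T {true} _ = refl

∑-filterᵇ : ∀ (p : A → Bool) xs (g : A → ℚ) → ∑ (filterᵇ p xs) g ≡ ∑[ x ← xs ] 𝟙 (p x) * g x
∑-filterᵇ p []       g = refl
∑-filterᵇ p (x ∷ xs) g = by-cases (p x) refl
  where
  by-cases : ∀ b → p x ≡ b → ∑ (filterᵇ p (x ∷ xs)) g ≡ ∑[ y ← x ∷ xs ] 𝟙 (p y) * g y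
  by-cases true  px = begin
    ∑ (filterᵇ p (x ∷ xs)) g       ≡⟨ cong (λ l → ∑ l g) (ListP.filter-accept (T? ∘ p) (subst T (sym px) tt)) ⟩
    g x + ∑ (filterᵇ p xs) g       ≡⟨ cong₂ _+_ (sym (ℚP.*-identityˡ (g x))) (∑-filterᵇ p xs g) ⟩
    1ℚ * g x + (∑[ y ← xs ] 𝟙 (p y) * g y)     ≡⟨ cong (λ b → 𝟙 b * g x + (∑[ y ← xs ] 𝟙 (p y) * g y)) (sym px) ⟩
    ∑[ y ← x ∷ xs ] 𝟙 (p y) * g y  ∎
  by-cases false px = begin
    ∑ (filterᵇ p (x ∷ xs)) g       ≡⟨ cong (λ l → ∑ l g) (ListP.filter-reject (T? ∘ p) (subst T px)) ⟩
    ∑ (filterᵇ p xs) g             ≡⟨ ∑-filterᵇ p xs g ⟩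
    ∑[ y ← xs ] 𝟙 (p y) * g y      ≡⟨ sym (trans (cong (_+ _) (ℚP.*-zeroˡ (g x))) (ℚP.+-identityˡ _)) ⟩
    0ℚ * g x + (∑[ y ← xs ] 𝟙 (p y) * g y)     ≡⟨ cong (λ b → 𝟙 b * g x + (∑[ y ← xs ] 𝟙 (p y) * g y)) (sym px) ⟩
    ∑[ y ← x ∷ xs ] 𝟙 (p y) * g y  ∎

∑-upTo-suc : ∀ M (φ : ℕ → ℚ) → ∑ (upTo (suc M)) φ ≡ φ 0 + (∑[ i ← upTo M ] φ (suc i))
∑-upTo-suc M φ = cong (φ 0 +_) (begin
  ∑ (applyUpTo suc M) φ      ≡⟨ cong (λ l → ∑ l φ) (sym (ListP.map-upTo suc M)) ⟩
  ∑ (map suc (upTo M)) φ     ≡⟨ ∑-map suc (upTo M) φ ⟩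
  ∑[ i ← upTo M ] φ (suc i)  ∎)

∑-upTo-δℕ : ∀ M c (ψ : ℕ → ℚ) → ∑[ i ← upTo M ] δℕ c i * ψ i ≡ 𝟙 (c ℕ.<ᵇ M) * ψ c
∑-upTo-δℕ zero    c       ψ = sym (ℚP.*-zeroˡ (ψ c))
∑-upTo-δℕ (suc M) zero    ψ = begin
  ∑[ i ← upTo (suc M) ] δℕ 0 i * ψ i  ≡⟨ ∑-upTo-suc M (λ i → δℕ 0 i * ψ i) ⟩
  1ℚ * ψ 0 + (∑[ i ← upTo M ] 0ℚ * ψ (suc i))
    ≡⟨ cong (1ℚ * ψ 0 +_) (∑-zero (upTo M) (λ i → ℚP.*-zeroˡ (ψ (suc i)))) ⟩
  1ℚ * ψ 0 + 0ℚ                       ≡⟨ ℚP.+-identityʳ _ ⟩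
  1ℚ * ψ 0                            ∎
∑-upTo-δℕ (suc M) (suc c) ψ = begin
  ∑[ i ← upTo (suc M) ] δℕ (suc c) i * ψ i  ≡⟨ ∑-upTo-suc M (λ i → δℕ (suc c) i * ψ i) ⟩
  0ℚ * ψ 0 + (∑[ i ← upTo M ] δℕ c i * ψ (suc i))
    ≡⟨ cong₂ _+_ (ℚP.*-zeroˡ (ψ 0)) (∑-upTo-δℕ M c (ψ ∘ suc)) ⟩
  0ℚ + 𝟙 (c ℕ.<ᵇ M) * ψ (suc c)             ≡⟨ ℚP.+-identityˡ _ ⟩
  𝟙 (c ℕ.<ᵇ M) * ψ (suc c)                  ∎

δℕ-∸ : ∀ g t n → 𝟙 (g ℕ.<ᵇ suc n) * δℕ t (n ℕ.∸ g) ≡ δℕ (g ℕ.+ t) n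
δℕ-∸ zero    t n       = ℚP.*-identityˡ (δℕ t n)
δℕ-∸ (suc g) t zero    = ℚP.*-zeroˡ (δℕ t 0)
δℕ-∸ (suc g) t (suc n) = δℕ-∸ g t n

shiftˡ : A → (List A × List A → ℚ) → List A × List A → ℚ
shiftˡ c Φ (u , v) = Φ (c ∷ u , v)

splits : List A → List (List A × List A)
splits []      = ([] , []) ∷ []
splits (a ∷ w) = ([] , a ∷ w) ∷ map (λ (u , v) → (a ∷ u , v)) (splits w)

∑-splits-∷ : ∀ a (w : List A) Φ → ∑ (splits (a ∷ w)) Φ ≡ Φ ([] , a ∷ w) + ∑ (splits w) (shiftˡ a Φ)
∑-splits-∷ a w Φ = cong (Φ ([] , a ∷ w) +_) (∑-map _ (splits w) Φ)

∑-splits-cong : ∀ (w : List A) {Φ Ψ : List A × List A → ℚ} →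
                (∀ u v → u ++ v ≡ w → Φ (u , v) ≡ Ψ (u , v)) → ∑ (splits w) Φ ≡ ∑ (splits w) Ψ
∑-splits-cong []      e = cong (_+ 0ℚ) (e [] [] refl)
∑-splits-cong (a ∷ w) e = cong₂ _+_ (e [] (a ∷ w) refl)
  (trans (∑-map _ (splits w) _)
    (trans (∑-splits-cong w (λ u v uv≡w → e (a ∷ u) v (cong (a ∷_) uv≡w))) (sym (∑-map _ (splits w) _))))

∑-splits-replicate : ∀ j (x : A) Φ → ∑ (splits (replicate (suc j) x)) Φ ≡
                     Φ (replicate (suc j) x , []) + ∑ (splits (replicate j x)) (λ (u , v) → Φ (u , x ∷ v))
∑-splits-replicate zero    x Φ = solve 2 (λ a b → a :+ (b :+ con 0ℚ) := b :+ (a :+ con 0ℚ)) refl (Φ ([] , x ∷ [])) (Φ (x ∷ [] , []))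
∑-splits-replicate (suc j) x Φ = begin
  ∑ (splits (x ∷ xs)) Φ
    ≡⟨ ∑-splits-∷ x xs Φ ⟩
  Φ ([] , x ∷ xs) + ∑ (splits xs) (shiftˡ x Φ)
    ≡⟨ cong (Φ ([] , x ∷ xs) +_) (∑-splits-replicate j x (shiftˡ x Φ)) ⟩
  Φ ([] , x ∷ xs) + (Φ (x ∷ xs , []) + rest)
    ≡⟨ solve 3 (λ a b c → a :+ (b :+ c) := b :+ (a :+ c)) refl (Φ ([] , x ∷ xs)) (Φ (x ∷ xs , [])) rest ⟩
  Φ (x ∷ xs , []) + (Φ ([] , x ∷ xs) + rest)
    ≡⟨ cong (Φ (x ∷ xs , []) +_) (sym (∑-splits-∷ x (replicate j x) (λ (u , v) → Φ (u , x ∷ v)))) ⟩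
  Φ (x ∷ xs , []) + ∑ (splits xs) (λ (u , v) → Φ (u , x ∷ v)) ∎
  where
  xs = replicate (suc j) x
  rest = ∑ (splits (replicate j x)) (λ (u , v) → Φ (x ∷ u , x ∷ v))

Series : Set
Series = List ℕ → ℚ

infixl 7 _⋆_
_⋆_ : Series → Series → Series
(F ⋆ G) γ = ∑ (splits γ) (λ (γ₁ , γ₂) → F γ₁ * G γ₂)

⋆-∷ : ∀ F G c γ → (F ⋆ G) (c ∷ γ) ≡ F [] * G (c ∷ γ) + ((F ∘ (c ∷_)) ⋆ G) γ
⋆-∷ F G c γ = ∑-splits-∷ c γ (λ (u , v) → F u * G v)

⋆-congˡ : ∀ {F F′} G → (∀ w → F w ≡ F′ w) → ∀ γ → (F ⋆ G) γ ≡ (F′ ⋆ G) γ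
⋆-congˡ G e γ = ∑-cong (splits γ) (λ (γ₁ , γ₂) → cong (_* G γ₂) (e γ₁))

⋆-congʳ : ∀ F {G G′} → (∀ w → G w ≡ G′ w) → ∀ γ → (F ⋆ G) γ ≡ (F ⋆ G′) γ
⋆-congʳ F e γ = ∑-cong (splits γ) (λ (γ₁ , γ₂) → cong (F γ₁ *_) (e γ₂))

-- The same coefficients as coeff, but written as a sum that is visibly linear in x.
⟦_⟧ : NSym → Series
⟦ x ⟧ γ = ∑ x (λ (q , β) → q * δ β γ)

coeff≡⟦⟧ : ∀ x γ → coeff x γ ≡ ⟦ x ⟧ γ
coeff≡⟦⟧ []            γ = refl
coeff≡⟦⟧ ((q , β) ∷ x) γ with ListP.≡-dec ℕ._≟_ β γ
... | yes refl = cong₂ _+_ (sym (trans (cong (q *_) (δ-refl β)) (ℚP.*-identityʳ q))) (coeff≡⟦⟧ x γ)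
... | no β≢γ   = begin
  coeff x γ                ≡⟨ sym (ℚP.+-identityˡ _) ⟩
  0ℚ + coeff x γ           ≡⟨ cong₂ _+_ (sym (trans (cong (q *_) (δ-≢ β γ β≢γ)) (ℚP.*-zeroʳ q))) (coeff≡⟦⟧ x γ) ⟩
  q * δ β γ + ⟦ x ⟧ γ      ∎

⟦sumN⟧ : ∀ xs γ → ⟦ sumN xs ⟧ γ ≡ ∑[ x ← xs ] ⟦ x ⟧ γ
⟦sumN⟧ []       γ = refl
⟦sumN⟧ (x ∷ xs) γ = trans (∑-++ x (sumN xs) _) (cong (⟦ x ⟧ γ +_) (⟦sumN⟧ xs γ))

⟦scale⟧ : ∀ c x γ → ⟦ scale c x ⟧ γ ≡ c * ⟦ x ⟧ γ
⟦scale⟧ c x γ = begin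
  ⟦ scale c x ⟧ γ                    ≡⟨ ∑-map _ x _ ⟩
  ∑ x (λ (q , β) → c * q * δ β γ)    ≡⟨ ∑-cong x (λ (q , β) → ℚP.*-assoc c q (δ β γ)) ⟩
  ∑ x (λ (q , β) → c * (q * δ β γ))  ≡⟨ sym (∑-*ˡ x c _) ⟩
  c * ⟦ x ⟧ γ                        ∎

δ-++ : ∀ α β γ → δ (α ++ β) γ ≡ (δ α ⋆ δ β) γ
δ-++ []      β []      = sym (trans (ℚP.+-identityʳ _) (ℚP.*-identityˡ (δ β [])))
δ-++ []      β (c ∷ γ) = sym (begin
  (δ [] ⋆ δ β) (c ∷ γ)                ≡⟨ ⋆-∷ (δ []) (δ β) c γ ⟩
  1ℚ * δ β (c ∷ γ) + (δ [] ∘ (c ∷_) ⋆ δ β) γ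
    ≡⟨ cong₂ _+_ (ℚP.*-identityˡ (δ β (c ∷ γ))) (∑-zero (splits γ) (λ (u , v) → ℚP.*-zeroˡ (δ β v))) ⟩
  δ β (c ∷ γ) + 0ℚ                    ≡⟨ ℚP.+-identityʳ _ ⟩
  δ β (c ∷ γ)                         ∎)
δ-++ (a ∷ α) β []      = sym (trans (ℚP.+-identityʳ _) (ℚP.*-zeroˡ (δ β [])))
δ-++ (a ∷ α) β (c ∷ γ) = begin
  δℕ a c * δ (α ++ β) γ                ≡⟨ cong (δℕ a c *_) (δ-++ α β γ) ⟩
  δℕ a c * (δ α ⋆ δ β) γ               ≡⟨ ∑-*ˡ (splits γ) (δℕ a c) _ ⟩
  ∑ (splits γ) (λ (u , v) → δℕ a c * (δ α u * δ β v))
    ≡⟨ ∑-cong (splits γ) (λ (u , v) → sym (ℚP.*-assoc (δℕ a c) (δ α u) (δ β v))) ⟩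
  (δ (a ∷ α) ∘ (c ∷_) ⋆ δ β) γ         ≡⟨ sym (ℚP.+-identityˡ _) ⟩
  0ℚ + (δ (a ∷ α) ∘ (c ∷_) ⋆ δ β) γ    ≡⟨ cong (_+ (δ (a ∷ α) ∘ (c ∷_) ⋆ δ β) γ) (sym (ℚP.*-zeroˡ (δ β (c ∷ γ)))) ⟩
  0ℚ * δ β (c ∷ γ) + (δ (a ∷ α) ∘ (c ∷_) ⋆ δ β) γ  ≡⟨ sym (⋆-∷ (δ (a ∷ α)) (δ β) c γ) ⟩
  (δ (a ∷ α) ⋆ δ β) (c ∷ γ)            ∎

⟦·N⟧ : ∀ x y γ → ⟦ x ·N y ⟧ γ ≡ (⟦ x ⟧ ⋆ ⟦ y ⟧) γ
⟦·N⟧ x y γ = begin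
  ⟦ x ·N y ⟧ γ
    ≡⟨ trans (∑-concatMap _ x _) (∑-cong x (λ _ → ∑-map _ y _)) ⟩
  ∑ x (λ (p , α) → ∑ y (λ (q , β) → p * q * δ (α ++ β) γ))
    ≡⟨ ∑-cong x (λ (p , α) → ∑-cong y (λ (q , β) → split-term p α q β)) ⟩
  ∑[ a ← x ] ∑[ b ← y ] ∑[ s ← splits γ ] term a b s
    ≡⟨ ∑-cong x (λ a → ∑-swap y (splits γ) (term a)) ⟩
  ∑[ a ← x ] ∑[ s ← splits γ ] ∑[ b ← y ] term a b s
    ≡⟨ ∑-swap x (splits γ) _ ⟩
  ∑[ s ← splits γ ] ∑[ a ← x ] ∑[ b ← y ] term a b s
    ≡⟨ ∑-cong (splits γ) (λ (u , v) → sym (∑*∑ x y _ _)) ⟩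
  (⟦ x ⟧ ⋆ ⟦ y ⟧) γ ∎
  where
  term : ℚ × List ℕ → ℚ × List ℕ → List ℕ × List ℕ → ℚ
  term (p , α) (q , β) (u , v) = (p * δ α u) * (q * δ β v)
  split-term : ∀ p α q β → p * q * δ (α ++ β) γ ≡ ∑[ s ← splits γ ] term (p , α) (q , β) s
  split-term p α q β = begin
    p * q * δ (α ++ β) γ  ≡⟨ cong (p * q *_) (δ-++ α β γ) ⟩
    p * q * (δ α ⋆ δ β) γ ≡⟨ ∑-*ˡ (splits γ) (p * q) _ ⟩
    ∑ (splits γ) (λ (u , v) → p * q * (δ α u * δ β v))
      ≡⟨ ∑-cong (splits γ) (λ (u , v) →
           solve 4 (λ p q a b → (p :* q) :* (a :* b) := (p :* a) :* (q :* b)) refl p q (δ α u) (δ β v)) ⟩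
    ∑[ s ← splits γ ] term (p , α) (q , β) s ∎

⟦oneN⟧-⋆ : ∀ G γ → (⟦ oneN ⟧ ⋆ G) γ ≡ G γ
⟦oneN⟧-⋆ G []      = trans (ℚP.+-identityʳ _) (ℚP.*-identityˡ (G []))
⟦oneN⟧-⋆ G (a ∷ γ) = begin
  (⟦ oneN ⟧ ⋆ G) (a ∷ γ)                        ≡⟨ ⋆-∷ ⟦ oneN ⟧ G a γ ⟩
  1ℚ * G (a ∷ γ) + ((⟦ oneN ⟧ ∘ (a ∷_)) ⋆ G) γ
    ≡⟨ cong₂ _+_ (ℚP.*-identityˡ (G (a ∷ γ))) (∑-zero (splits γ) (λ (_ , γ₂) → ℚP.*-zeroˡ (G γ₂))) ⟩
  G (a ∷ γ) + 0ℚ                                ≡⟨ ℚP.+-identityʳ _ ⟩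
  G (a ∷ γ)                                     ∎

⋆-⟦oneN⟧ : ∀ F γ → (F ⋆ ⟦ oneN ⟧) γ ≡ F γ
⋆-⟦oneN⟧ F []      = trans (ℚP.+-identityʳ _) (ℚP.*-identityʳ (F []))
⋆-⟦oneN⟧ F (a ∷ γ) = begin
  (F ⋆ ⟦ oneN ⟧) (a ∷ γ)                        ≡⟨ ⋆-∷ F ⟦ oneN ⟧ a γ ⟩
  F [] * 0ℚ + ((F ∘ (a ∷_)) ⋆ ⟦ oneN ⟧) γ       ≡⟨ cong₂ _+_ (ℚP.*-zeroʳ (F [])) (⋆-⟦oneN⟧ (F ∘ (a ∷_)) γ) ⟩
  0ℚ + F (a ∷ γ)                                ≡⟨ ℚP.+-identityˡ _ ⟩
  F (a ∷ γ)                                     ∎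

Hˢ : ℕ → Series → Series
Hˢ n F []      = 0ℚ
Hˢ n F (k ∷ γ) = δℕ n k * F γ

⟦Hmul⟧ : ∀ m x γ → ⟦ Hmul (suc m) x ⟧ γ ≡ Hˢ (suc m) ⟦ x ⟧ γ
⟦Hmul⟧ m x []      = trans (∑-map _ x _) (∑-zero x (λ (q , β) → ℚP.*-zeroʳ q))
⟦Hmul⟧ m x (k ∷ γ) = begin
  ⟦ Hmul (suc m) x ⟧ (k ∷ γ)                    ≡⟨ ∑-map _ x _ ⟩
  ∑ x (λ (q , β) → q * (δℕ (suc m) k * δ β γ))
    ≡⟨ ∑-cong x (λ (q , β) → solve 3 (λ q a b → q :* (a :* b) := a :* (q :* b)) refl q (δℕ (suc m) k) (δ β γ)) ⟩
  ∑ x (λ (q , β) → δℕ (suc m) k * (q * δ β γ))  ≡⟨ sym (∑-*ˡ x (δℕ (suc m) k) _) ⟩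
  δℕ (suc m) k * ⟦ x ⟧ γ                         ∎

isCompᵇ : List ℕ → Bool
isCompᵇ []          = true
isCompᵇ (zero ∷ _)  = false
isCompᵇ (suc _ ∷ w) = isCompᵇ w

𝟙-isComp-++ : ∀ u v → 𝟙 (isCompᵇ (u ++ v)) ≡ 𝟙 (isCompᵇ u) * 𝟙 (isCompᵇ v)
𝟙-isComp-++ []          v = sym (ℚP.*-identityˡ _)
𝟙-isComp-++ (zero ∷ u)  v = sym (ℚP.*-zeroˡ (𝟙 (isCompᵇ v)))
𝟙-isComp-++ (suc _ ∷ u) v = 𝟙-isComp-++ u v

isComp-++ʳ : ∀ u v → T (isCompᵇ (u ++ v)) → T (isCompᵇ v)
isComp-++ʳ []          v c = c
isComp-++ʳ (suc _ ∷ u) v c = isComp-++ʳ u v c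

sum-replicate-1 : ∀ i → sum (replicate i 1) ≡ i
sum-replicate-1 zero    = refl
sum-replicate-1 (suc i) = cong suc (sum-replicate-1 i)

isComp-replicate-1 : ∀ i → T (isCompᵇ (replicate i 1))
isComp-replicate-1 zero    = tt
isComp-replicate-1 (suc i) = isComp-replicate-1 i

incHead : List ℕ → List ℕ
incHead []      = []
incHead (a ∷ c) = suc a ∷ c

∑-comps1-suc : ∀ n (h : Series) → ∑ (comps1 (suc n)) h ≡ ∑ (comps1 n) (h ∘ (1 ∷_)) + ∑ (comps1 n) (h ∘ incHead)
∑-comps1-suc n h = begin
  ∑ (comps1 (suc n)) h
    ≡⟨ ∑-concatMap _ (comps1 n) h ⟩
  _ ≡⟨ ∑-cong (comps1 n) {g = λ c → h (1 ∷ c) + h (incHead c)} (λ where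
         []      → cong (h (1 ∷ []) +_) (ℚP.+-identityʳ _)
         (a ∷ c) → cong (h (1 ∷ a ∷ c) +_) (ℚP.+-identityʳ _)) ⟩
  ∑[ c ← comps1 n ] (h (1 ∷ c) + h (incHead c))
    ≡⟨ ∑-+ (comps1 n) (h ∘ (1 ∷_)) (h ∘ incHead) ⟩
  ∑ (comps1 n) (h ∘ (1 ∷_)) + ∑ (comps1 n) (h ∘ incHead) ∎

∑-comps1 : ∀ n (h : Series) →
           ∑ (comps1 n) h ≡ ∑[ i ← upTo (suc n) ] ∑ (compositions (n ℕ.∸ i)) (h ∘ (suc i ∷_))
∑-comps1 zero    h = sym (ℚP.+-identityʳ (h (1 ∷ []) + 0ℚ))
∑-comps1 (suc n) h = begin
  ∑ (comps1 (suc n)) h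
    ≡⟨ ∑-comps1-suc n h ⟩
  ∑ (comps1 n) (h ∘ (1 ∷_)) + ∑ (comps1 n) (h ∘ incHead)
    ≡⟨ cong (∑ (comps1 n) (h ∘ (1 ∷_)) +_) (∑-comps1 n (h ∘ incHead)) ⟩
  ∑ (comps1 n) (h ∘ (1 ∷_)) + (∑[ i ← upTo (suc n) ] ∑ (compositions (n ℕ.∸ i)) (h ∘ (suc (suc i) ∷_)))
    ≡⟨ sym (∑-upTo-suc (suc n) (λ i → ∑ (compositions (suc n ℕ.∸ i)) (h ∘ (suc i ∷_)))) ⟩
  ∑[ i ← upTo (suc (suc n)) ] ∑ (compositions (suc n ℕ.∸ i)) (h ∘ (suc i ∷_)) ∎

comps1-sum : ∀ n → All (λ β → sum β ≡ suc n) (comps1 n)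
comps1-sum zero    = refl ∷ []
comps1-sum (suc n) = concat⁺ (map⁺ (All.map (λ { {_ ∷ _} e → cong suc e ∷ cong suc e ∷ [] }) (comps1-sum n)))

compositions-sum : ∀ n → All (λ β → sum β ≡ n) (compositions n)
compositions-sum zero    = refl ∷ []
compositions-sum (suc n) = comps1-sum n

∑-compositions-δ : ∀ n (h : Series) γ →
  ∑[ d ← compositions n ] h d * δ d γ ≡ 𝟙 (isCompᵇ γ) * δℕ (sum γ) n * h γ
∑-compositions-δ zero h [] = trans (ℚP.+-identityʳ _) (ℚP.*-comm (h []) 1ℚ)
∑-compositions-δ zero h (zero ∷ γ) =
  trans (trans (ℚP.+-identityʳ _) (ℚP.*-zeroʳ (h [])))
        (sym (trans (cong (_* h (0 ∷ γ)) (ℚP.*-zeroˡ (δℕ (sum γ) 0))) (ℚP.*-zeroˡ (h (0 ∷ γ)))))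
∑-compositions-δ zero h (suc g ∷ γ) = begin
  h [] * 0ℚ + 0ℚ     ≡⟨ trans (ℚP.+-identityʳ _) (ℚP.*-zeroʳ (h [])) ⟩
  0ℚ                 ≡⟨ sym (trans (cong (_* h (suc g ∷ γ)) (ℚP.*-zeroʳ (𝟙 (isCompᵇ γ)))) (ℚP.*-zeroˡ (h (suc g ∷ γ)))) ⟩
  𝟙 (isCompᵇ γ) * 0ℚ * h (suc g ∷ γ) ∎
∑-compositions-δ (suc n) h γ =
  trans (∑-comps1 n (λ d → h d * δ d γ)) (by-first-part γ)
  where
  by-first-part : ∀ γ → ∑[ i ← upTo (suc n) ] ∑[ β ← compositions (n ℕ.∸ i) ] h (suc i ∷ β) * δ (suc i ∷ β) γ
                        ≡ 𝟙 (isCompᵇ γ) * δℕ (sum γ) (suc n) * h γ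
  by-first-part [] = begin
    _  ≡⟨ ∑-zero (upTo (suc n)) (λ i → ∑-zero (compositions (n ℕ.∸ i)) (λ β → ℚP.*-zeroʳ (h (suc i ∷ β)))) ⟩
    0ℚ ≡⟨ sym (ℚP.*-zeroˡ (h [])) ⟩
    _  ∎
  by-first-part (zero ∷ γ) = begin
    _  ≡⟨ ∑-zero (upTo (suc n)) (λ i → ∑-zero (compositions (n ℕ.∸ i)) (λ β →
            trans (cong (h (suc i ∷ β) *_) (ℚP.*-zeroˡ (δ β γ))) (ℚP.*-zeroʳ (h (suc i ∷ β))))) ⟩
    0ℚ ≡⟨ sym (trans (cong (_* h (0 ∷ γ)) (ℚP.*-zeroˡ (δℕ (sum γ) (suc n)))) (ℚP.*-zeroˡ (h (0 ∷ γ)))) ⟩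
    _  ∎
  by-first-part (suc g ∷ γ) = begin
    ∑[ i ← upTo (suc n) ] ∑[ β ← compositions (n ℕ.∸ i) ] h (suc i ∷ β) * (δℕ i g * δ β γ)
      ≡⟨ ∑-cong (upTo (suc n)) (λ i → pull-out-δℕ i) ⟩
    ∑[ i ← upTo (suc n) ] δℕ g i * (𝟙 (isCompᵇ γ) * δℕ (sum γ) (n ℕ.∸ i) * h (suc i ∷ γ))
      ≡⟨ ∑-upTo-δℕ (suc n) g _ ⟩
    𝟙 (g ℕ.<ᵇ suc n) * (𝟙 (isCompᵇ γ) * δℕ (sum γ) (n ℕ.∸ g) * h (suc g ∷ γ))
      ≡⟨ solve 4 (λ a c d x → a :* (c :* d :* x) := c :* (a :* d) :* x) refl
           (𝟙 (g ℕ.<ᵇ suc n)) (𝟙 (isCompᵇ γ)) (δℕ (sum γ) (n ℕ.∸ g)) (h (suc g ∷ γ)) ⟩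
    𝟙 (isCompᵇ γ) * (𝟙 (g ℕ.<ᵇ suc n) * δℕ (sum γ) (n ℕ.∸ g)) * h (suc g ∷ γ)
      ≡⟨ cong (λ z → 𝟙 (isCompᵇ γ) * z * h (suc g ∷ γ)) (δℕ-∸ g (sum γ) n) ⟩
    𝟙 (isCompᵇ γ) * δℕ (g ℕ.+ sum γ) n * h (suc g ∷ γ) ∎
    where
    pull-out-δℕ : ∀ i → ∑[ β ← compositions (n ℕ.∸ i) ] h (suc i ∷ β) * (δℕ i g * δ β γ)
                        ≡ δℕ g i * (𝟙 (isCompᵇ γ) * δℕ (sum γ) (n ℕ.∸ i) * h (suc i ∷ γ))
    pull-out-δℕ i = begin
      ∑[ β ← compositions (n ℕ.∸ i) ] h (suc i ∷ β) * (δℕ i g * δ β γ)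
        ≡⟨ ∑-cong (compositions (n ℕ.∸ i)) (λ β →
             solve 3 (λ x a b → x :* (a :* b) := a :* (x :* b)) refl (h (suc i ∷ β)) (δℕ i g) (δ β γ)) ⟩
      ∑[ β ← compositions (n ℕ.∸ i) ] δℕ i g * (h (suc i ∷ β) * δ β γ)
        ≡⟨ sym (∑-*ˡ (compositions (n ℕ.∸ i)) (δℕ i g) _) ⟩
      δℕ i g * (∑[ β ← compositions (n ℕ.∸ i) ] h (suc i ∷ β) * δ β γ)
        ≡⟨ cong₂ _*_ (δℕ-sym i g) (∑-compositions-δ (n ℕ.∸ i) (h ∘ (suc i ∷_)) γ) ⟩
      δℕ g i * (𝟙 (isCompᵇ γ) * δℕ (sum γ) (n ℕ.∸ i) * h (suc i ∷ γ)) ∎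

∑-qsh-∷ : ∀ a u b v (f : Series) → ∑ (qsh (a ∷ u) (b ∷ v)) f ≡
  ∑ (qsh u (b ∷ v)) (f ∘ (a ∷_)) + (∑ (qsh (a ∷ u) v) (f ∘ (b ∷_)) + ∑ (qsh u v) (f ∘ (a ℕ.+ b ∷_)))
∑-qsh-∷ a u b v f =
  trans (∑-++ (map (a ∷_) (qsh u (b ∷ v))) _ f)
    (cong₂ _+_ (∑-map (a ∷_) (qsh u (b ∷ v)) f)
      (trans (∑-++ (map (b ∷_) (qsh (a ∷ u) v)) _ f)
        (cong₂ _+_ (∑-map (b ∷_) (qsh (a ∷ u) v) f) (∑-map (a ℕ.+ b ∷_) (qsh u v) f))))

∑-qsh-[] : ∀ u (f : Series) → ∑ (qsh u []) f ≡ f u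
∑-qsh-[] []      f = ℚP.+-identityʳ (f [])
∑-qsh-[] (a ∷ u) f = ℚP.+-identityʳ (f (a ∷ u))

qsh-sum : ∀ u v → All (λ w → sum w ≡ sum u ℕ.+ sum v) (qsh u v)
qsh-sum []      v       = refl ∷ []
qsh-sum (a ∷ u) []      = sym (ℕP.+-identityʳ _) ∷ []
qsh-sum (a ∷ u) (b ∷ v) =
  ++⁺ (map⁺ (All.map (λ e → trans (cong (a ℕ.+_) e) (sym (ℕP.+-assoc a (sum u) _))) (qsh-sum u (b ∷ v))))
      (++⁺ (map⁺ (All.map (λ e → trans (cong (b ℕ.+_) e) (x∙yz≈y∙xz b _ (sum v))) (qsh-sum (a ∷ u) v)))
           (map⁺ (All.map (λ e → trans (cong (a ℕ.+ b ℕ.+_) e) (interchange a b (sum u) (sum v))) (qsh-sum u v))))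

qsh-isComp : ∀ u v → T (isCompᵇ u) → T (isCompᵇ v) → All (T ∘ isCompᵇ) (qsh u v)
qsh-isComp []          v           cu cv = cv ∷ []
qsh-isComp (a ∷ u)     []          cu cv = cu ∷ []
qsh-isComp (suc a ∷ u) (suc b ∷ v) cu cv =
  ++⁺ (map⁺ (qsh-isComp u (suc b ∷ v) cu cv))
      (++⁺ (map⁺ (qsh-isComp (suc a ∷ u) v cu cv)) (map⁺ (qsh-isComp u v cu cv)))

sgn-+ : ∀ m n → sgn (m ℕ.+ n) ≡ sgn m * sgn n
sgn-+ zero    n = sym (ℚP.*-identityˡ (sgn n))
sgn-+ (suc m) n = trans (cong -_ (sgn-+ m n)) (ℚP.neg-distribˡ-* (sgn m) (sgn n))

-- χ γ = (−1)^(|γ| − ℓ(γ))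
χ : List ℕ → ℚ
χ []      = 1ℚ
χ (a ∷ w) = - sgn a * χ w

χ-qsh : ∀ u v → ∑ (qsh u v) χ ≡ χ u * χ v
χ-qsh []      v       = trans (ℚP.+-identityʳ (χ v)) (sym (ℚP.*-identityˡ (χ v)))
χ-qsh (a ∷ u) []      = trans (ℚP.+-identityʳ (χ (a ∷ u))) (sym (ℚP.*-identityʳ (χ (a ∷ u))))
χ-qsh (a ∷ u) (b ∷ v) = begin
  ∑ (qsh (a ∷ u) (b ∷ v)) χ
    ≡⟨ ∑-qsh-∷ a u b v χ ⟩
  ∑ (qsh u (b ∷ v)) (χ ∘ (a ∷_)) + (∑ (qsh (a ∷ u) v) (χ ∘ (b ∷_)) + ∑ (qsh u v) (χ ∘ (a ℕ.+ b ∷_)))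
    ≡⟨ sym (cong₂ _+_ (∑-*ˡ (qsh u (b ∷ v)) (- sgn a) χ)
             (cong₂ _+_ (∑-*ˡ (qsh (a ∷ u) v) (- sgn b) χ) (∑-*ˡ (qsh u v) (- sgn (a ℕ.+ b)) χ))) ⟩
  - sgn a * ∑ (qsh u (b ∷ v)) χ + (- sgn b * ∑ (qsh (a ∷ u) v) χ + - sgn (a ℕ.+ b) * ∑ (qsh u v) χ)
    ≡⟨ cong₂ _+_ (cong (- sgn a *_) (χ-qsh u (b ∷ v)))
         (cong₂ _+_ (cong (- sgn b *_) (χ-qsh (a ∷ u) v)) (cong₂ _*_ (cong -_ (sgn-+ a b)) (χ-qsh u v))) ⟩
  - sgn a * (χ u * (- sgn b * χ v)) + (- sgn b * (- sgn a * χ u * χ v) + - (sgn a * sgn b) * (χ u * χ v))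
    ≡⟨ solve 4 (λ sa sb xu xv →
         (:- sa) :* (xu :* ((:- sb) :* xv)) :+ ((:- sb) :* ((:- sa) :* xu :* xv) :+ (:- (sa :* sb)) :* (xu :* xv))
           := (:- sa) :* xu :* ((:- sb) :* xv)) refl (sgn a) (sgn b) (χ u) (χ v) ⟩
  χ (a ∷ u) * χ (b ∷ v) ∎

χ-replicate-1 : ∀ i → χ (replicate i 1) ≡ 1ℚ
χ-replicate-1 zero    = refl
χ-replicate-1 (suc i) = cong (1ℚ *_) (χ-replicate-1 i)

fromℕq-suc : ∀ n → fromℕq (suc n) ≡ 1ℚ + fromℕq n
fromℕq-suc n = ℚP.toℚᵘ-injective
  (ᵘ.≃-trans (ℚP.toℚᵘ-fromℚᵘ (mkℚᵘ (+ suc n) 0))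
  (ᵘ.≃-trans (*≡* (ZS.solve 1 (λ x → (ZS.con (+ 1) ZS.:+ x) ZS.:* ZS.con (+ 1)
                                     ZS.:= (ZS.con (+ 1) ZS.:+ x ZS.:* ZS.con (+ 1)) ZS.:* ZS.con (+ 1)) refl (+ n)))
  (ᵘ.≃-sym (ᵘ.≃-trans (ℚP.toℚᵘ-homo-+ 1ℚ (fromℕq n)) (ᵘ.+-congʳ (mkℚᵘ (+ 1) 0) (ℚP.toℚᵘ-fromℚᵘ (mkℚᵘ (+ n) 0)))))))
  where
  open import Data.Integer using (+_)
  open import Data.Rational.Unnormalised using (mkℚᵘ; *≡*)
  import Data.Rational.Unnormalised.Properties as ᵘ
  import Data.Integer.Solver as ℤSolver
  module ZS = ℤSolver.+-*-Solver

countL≡∑δ : ∀ α ws → fromℕq (countL α ws) ≡ ∑[ w ← ws ] δ w α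
countL≡∑δ α []       = refl
countL≡∑δ α (w ∷ ws) = by-cases (ListP.≡-dec ℕ._≟_ w α)
  where
  by-cases : Dec (w ≡ α) → fromℕq (countL α (w ∷ ws)) ≡ ∑ (w ∷ ws) (λ v → δ v α)
  by-cases (yes refl) = begin
    fromℕq (countL w (w ∷ ws))  ≡⟨ cong (fromℕq ∘ length) (ListP.filter-accept (λ v → ListP.≡-dec ℕ._≟_ v w) {w} {ws} refl) ⟩
    fromℕq (suc (countL w ws))  ≡⟨ fromℕq-suc (countL w ws) ⟩
    1ℚ + fromℕq (countL w ws)   ≡⟨ cong₂ _+_ (sym (δ-refl w)) (countL≡∑δ w ws) ⟩
    ∑ (w ∷ ws) (λ v → δ v w)    ∎
  by-cases (no w≢α) = begin
    fromℕq (countL α (w ∷ ws))  ≡⟨ cong (fromℕq ∘ length) (ListP.filter-reject (λ v → ListP.≡-dec ℕ._≟_ v α) {w} {ws} w≢α) ⟩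
    fromℕq (countL α ws)        ≡⟨ countL≡∑δ α ws ⟩
    ∑ ws (λ v → δ v α)          ≡⟨ sym (ℚP.+-identityˡ _) ⟩
    0ℚ + ∑ ws (λ v → δ v α)     ≡⟨ cong (_+ ∑ ws (λ v → δ v α)) (sym (δ-≢ w α w≢α)) ⟩
    ∑ (w ∷ ws) (λ v → δ v α)    ∎

-- The operators M_u^⊥ and 𝔹_m on coefficient series

-- M_u^⊥ on coefficient series: (M⊥ u F) γ = ⟨F , M_u M_γ⟩ for compositions γ, and 0 otherwise.
M⊥ : List ℕ → Series → Series
M⊥ u F γ = 𝟙 (isCompᵇ γ) * ∑ (qsh u γ) F

M⊥-cong : ∀ u {F G : Series} → (∀ w → F w ≡ G w) → ∀ γ → M⊥ u F γ ≡ M⊥ u G γ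
M⊥-cong u e γ = cong (𝟙 (isCompᵇ γ) *_) (∑-cong (qsh u γ) e)

∑-qsh-δ-vanishes : ∀ u γ α → sum α ℕ.< sum γ → ∑[ w ← qsh u γ ] δ w α ≡ 0ℚ
∑-qsh-δ-vanishes u γ α α<γ = trans (∑-cong-All (All.map (λ {w} → vanish w) (qsh-sum u γ))) (∑-zero (qsh u γ) (λ _ → refl))
  where
  vanish : ∀ w → sum w ≡ sum u ℕ.+ sum γ → δ w α ≡ 0ℚ
  vanish w e = δ-≢ w α (λ w≡α →
    ℕP.<⇒≢ (ℕP.<-≤-trans α<γ (ℕP.m≤n+m (sum γ) (sum u))) (sym (trans (sym e) (cong sum w≡α))))

⟦perpBasis⟧ : ∀ i α γ → ⟦ perpBasis i α ⟧ γ ≡ 𝟙 (isCompᵇ γ) * (∑[ w ← qsh (replicate i 1) γ ] δ w α)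
⟦perpBasis⟧ i α γ = begin
  ⟦ perpBasis i α ⟧ γ
    ≡⟨ ∑-map (λ d → (h d , d)) (compositionsUpTo (sum α)) (λ (q , d) → q * δ d γ) ⟩
  ∑[ d ← compositionsUpTo (sum α) ] h d * δ d γ
    ≡⟨ ∑-concatMap compositions (upTo (suc (sum α))) (λ d → h d * δ d γ) ⟩
  ∑[ n ← upTo (suc (sum α)) ] ∑[ d ← compositions n ] h d * δ d γ
    ≡⟨ ∑-cong (upTo (suc (sum α))) (λ n → trans (∑-compositions-δ n h γ)
         (solve 3 (λ c d x → c :* d :* x := d :* (c :* x)) refl (𝟙 (isCompᵇ γ)) (δℕ (sum γ) n) (h γ))) ⟩
  ∑[ n ← upTo (suc (sum α)) ] δℕ (sum γ) n * (𝟙 (isCompᵇ γ) * h γ)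
    ≡⟨ ∑-upTo-δℕ (suc (sum α)) (sum γ) _ ⟩
  𝟙 (sum γ ℕ.<ᵇ suc (sum α)) * (𝟙 (isCompᵇ γ) * h γ)
    ≡⟨ cong (λ z → 𝟙 (sum γ ℕ.<ᵇ suc (sum α)) * (𝟙 (isCompᵇ γ) * z)) (countL≡∑δ α (qsh u γ)) ⟩
  𝟙 (sum γ ℕ.<ᵇ suc (sum α)) * (𝟙 (isCompᵇ γ) * S)
    ≡⟨ solve 3 (λ a c x → a :* (c :* x) := c :* (a :* x)) refl (𝟙 (sum γ ℕ.<ᵇ suc (sum α))) (𝟙 (isCompᵇ γ)) S ⟩
  𝟙 (isCompᵇ γ) * (𝟙 (sum γ ℕ.<ᵇ suc (sum α)) * S)
    ≡⟨ cong (𝟙 (isCompᵇ γ) *_) degree-cutoff ⟩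
  𝟙 (isCompᵇ γ) * S ∎
  where
  u = replicate i 1
  h : Series
  h d = fromℕq (countL α (qsh u d))
  S = ∑[ w ← qsh u γ ] δ w α
  degree-cutoff : 𝟙 (sum γ ℕ.<ᵇ suc (sum α)) * S ≡ S
  degree-cutoff with sum γ ℕ.<ᵇ suc (sum α) in eq
  ... | true  = ℚP.*-identityˡ S
  ... | false = trans (ℚP.*-zeroˡ S) (sym (∑-qsh-δ-vanishes u γ α (ℕP.≮⇒≥ (λ lt → subst T eq (ℕP.<⇒<ᵇ lt)))))

⟦perp1⟧ : ∀ i x γ → ⟦ perp1 i x ⟧ γ ≡ M⊥ (replicate i 1) ⟦ x ⟧ γ
⟦perp1⟧ i x γ = begin
  ⟦ perp1 i x ⟧ γ
    ≡⟨ trans (∑-concatMap _ x _) (∑-cong x (λ (q , α) → ⟦scale⟧ q (perpBasis i α) γ)) ⟩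
  ∑ x (λ (q , α) → q * ⟦ perpBasis i α ⟧ γ)
    ≡⟨ ∑-cong x (λ (q , α) → trans (cong (q *_) (⟦perpBasis⟧ i α γ)) (move-inside q α)) ⟩
  ∑ x (λ (q , α) → 𝟙 (isCompᵇ γ) * (∑[ w ← qsh u γ ] q * δ α w))
    ≡⟨ sym (∑-*ˡ x (𝟙 (isCompᵇ γ)) _) ⟩
  𝟙 (isCompᵇ γ) * ∑ x (λ (q , α) → ∑[ w ← qsh u γ ] q * δ α w)
    ≡⟨ cong (𝟙 (isCompᵇ γ) *_) (∑-swap x (qsh u γ) _) ⟩
  M⊥ u ⟦ x ⟧ γ ∎
  where
  u = replicate i 1
  move-inside : ∀ q α → q * (𝟙 (isCompᵇ γ) * (∑[ w ← qsh u γ ] δ w α)) ≡ 𝟙 (isCompᵇ γ) * (∑[ w ← qsh u γ ] q * δ α w)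
  move-inside q α = begin
    q * (𝟙 (isCompᵇ γ) * (∑[ w ← qsh u γ ] δ w α))  ≡⟨ solve 3 (λ q c s → q :* (c :* s) := c :* (q :* s)) refl q (𝟙 (isCompᵇ γ)) _ ⟩
    𝟙 (isCompᵇ γ) * (q * (∑[ w ← qsh u γ ] δ w α))  ≡⟨ cong (𝟙 (isCompᵇ γ) *_) (∑-*ˡ (qsh u γ) q _) ⟩
    𝟙 (isCompᵇ γ) * (∑[ w ← qsh u γ ] q * δ w α)    ≡⟨ cong (𝟙 (isCompᵇ γ) *_) (∑-cong (qsh u γ) (λ w → cong (q *_) (δ-sym w α))) ⟩
    𝟙 (isCompᵇ γ) * (∑[ w ← qsh u γ ] q * δ α w)    ∎

-- atDiff m k g is g (k − m) when m ≤ k, and 0 (not g 0) when k < m.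
atDiff : ℕ → ℕ → (ℕ → ℚ) → ℚ
atDiff zero    k       g = g k
atDiff (suc m) zero    g = 0ℚ
atDiff (suc m) (suc k) g = atDiff m k g

atDiff-cong : ∀ m k {g h : ℕ → ℚ} → (∀ i → g i ≡ h i) → atDiff m k g ≡ atDiff m k h
atDiff-cong zero    k       e = e k
atDiff-cong (suc m) zero    e = refl
atDiff-cong (suc m) (suc k) e = atDiff-cong m k e

atDiff-zero : ∀ m k {g} → (∀ i → g i ≡ 0ℚ) → atDiff m k g ≡ 0ℚ
atDiff-zero m k z = trans (atDiff-cong m k z) (atDiff-const-0 m k)
  where
  atDiff-const-0 : ∀ m k → atDiff m k (λ _ → 0ℚ) ≡ 0ℚ
  atDiff-const-0 zero    k       = refl
  atDiff-const-0 (suc m) zero    = refl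
  atDiff-const-0 (suc m) (suc k) = atDiff-const-0 m k

atDiff-∑ : ∀ m k (xs : List A) (g : A → ℕ → ℚ) → atDiff m k (λ i → ∑[ x ← xs ] g x i) ≡ ∑[ x ← xs ] atDiff m k (g x)
atDiff-∑ zero    k       xs g = refl
atDiff-∑ (suc m) zero    xs g = sym (∑-zero xs (λ _ → refl))
atDiff-∑ (suc m) (suc k) xs g = atDiff-∑ m k xs g

atDiff-suc : ∀ m k g → δℕ m k * g 0 + atDiff (suc m) k (g ∘ suc) ≡ atDiff m k g
atDiff-suc zero    zero    g = trans (ℚP.+-identityʳ _) (ℚP.*-identityˡ (g 0))
atDiff-suc zero    (suc k) g = trans (cong (_+ g (suc k)) (ℚP.*-zeroˡ (g 0))) (ℚP.+-identityˡ (g (suc k)))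
atDiff-suc (suc m) zero    g = trans (ℚP.+-identityʳ _) (ℚP.*-zeroˡ (g 0))
atDiff-suc (suc m) (suc k) g = atDiff-suc m k g

∑-upTo-δℕ-+ : ∀ N m k g → (∀ i → N ℕ.≤ i → g i ≡ 0ℚ) → ∑[ i ← upTo N ] δℕ (m ℕ.+ i) k * g i ≡ atDiff m k g
∑-upTo-δℕ-+ zero    m k g z = sym (atDiff-zero m k (λ i → z i ℕ.z≤n))
∑-upTo-δℕ-+ (suc N) m k g z = begin
  ∑[ i ← upTo (suc N) ] δℕ (m ℕ.+ i) k * g i
    ≡⟨ ∑-upTo-suc N (λ i → δℕ (m ℕ.+ i) k * g i) ⟩
  δℕ (m ℕ.+ 0) k * g 0 + (∑[ i ← upTo N ] δℕ (m ℕ.+ suc i) k * g (suc i))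
    ≡⟨ cong₂ _+_ (cong (λ n → δℕ n k * g 0) (ℕP.+-identityʳ m))
                 (∑-cong (upTo N) (λ i → cong (λ n → δℕ n k * g (suc i)) (ℕP.+-suc m i))) ⟩
  δℕ m k * g 0 + (∑[ i ← upTo N ] δℕ (suc m ℕ.+ i) k * g (suc i))
    ≡⟨ cong (δℕ m k * g 0 +_) (∑-upTo-δℕ-+ N (suc m) k (g ∘ suc) (λ i N≤i → z (suc i) (ℕ.s≤s N≤i))) ⟩
  δℕ m k * g 0 + atDiff (suc m) k (g ∘ suc)
    ≡⟨ atDiff-suc m k g ⟩
  atDiff m k g ∎

𝔹-term : Series → List ℕ → ℕ → ℚ
𝔹-term F γ i = sgn i * M⊥ (replicate i 1) F γ

𝔹ˢ : ℕ → Series → Series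
𝔹ˢ m F []      = 0ℚ
𝔹ˢ m F (k ∷ γ) = atDiff m k (𝔹-term F γ)

𝔹ˢ-cong : ∀ m {F G} → (∀ w → F w ≡ G w) → ∀ γ → 𝔹ˢ m F γ ≡ 𝔹ˢ m G γ
𝔹ˢ-cong m e []      = refl
𝔹ˢ-cong m e (k ∷ γ) = atDiff-cong m k (λ i → cong (sgn i *_) (M⊥-cong (replicate i 1) e γ))

𝔹ˢ-∑ : ∀ m (L : List A) (H : A → Series) γ → 𝔹ˢ m (λ w → ∑[ β ← L ] H β w) γ ≡ ∑[ β ← L ] 𝔹ˢ m (H β) γ
𝔹ˢ-∑ m L H []      = sym (∑-zero L (λ _ → refl))
𝔹ˢ-∑ m L H (k ∷ γ) = trans (atDiff-cong m k linear) (atDiff-∑ m k L (λ β → 𝔹-term (H β) γ))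
  where
  linear : ∀ i → 𝔹-term (λ w → ∑[ β ← L ] H β w) γ i ≡ ∑[ β ← L ] 𝔹-term (H β) γ i
  linear i = begin
    sgn i * (𝟙 (isCompᵇ γ) * (∑[ w ← qsh (replicate i 1) γ ] ∑[ β ← L ] H β w))
      ≡⟨ cong (λ x → sgn i * (𝟙 (isCompᵇ γ) * x)) (∑-swap (qsh (replicate i 1) γ) L (λ w β → H β w)) ⟩
    sgn i * (𝟙 (isCompᵇ γ) * (∑[ β ← L ] ∑ (qsh (replicate i 1) γ) (H β)))
      ≡⟨ cong (sgn i *_) (∑-*ˡ L (𝟙 (isCompᵇ γ)) _) ⟩
    sgn i * (∑[ β ← L ] M⊥ (replicate i 1) (H β) γ)
      ≡⟨ ∑-*ˡ L (sgn i) _ ⟩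
    ∑[ β ← L ] 𝔹-term (H β) γ i ∎

⟦⟧-vanishes-above-degBound : ∀ x w → degBound x ℕ.< sum w → ⟦ x ⟧ w ≡ 0ℚ
⟦⟧-vanishes-above-degBound []            w lt = refl
⟦⟧-vanishes-above-degBound ((q , β) ∷ x) w lt = begin
  q * δ β w + ⟦ x ⟧ w
    ≡⟨ cong₂ _+_ (trans (cong (q *_) (δ-≢ β w β≢w)) (ℚP.*-zeroʳ q))
                 (⟦⟧-vanishes-above-degBound x w (ℕP.≤-<-trans (ℕP.m≤n+m (degBound x) (sum β)) lt)) ⟩
  0ℚ + 0ℚ ≡⟨ ℚP.+-identityˡ 0ℚ ⟩
  0ℚ      ∎
  where
  β≢w : β ≢ w
  β≢w refl = ℕP.<⇒≱ lt (ℕP.m≤m+n (sum β) (degBound x))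

M⊥-vanishes-above-degBound : ∀ x i γ → degBound x ℕ.< i → M⊥ (replicate i 1) ⟦ x ⟧ γ ≡ 0ℚ
M⊥-vanishes-above-degBound x i γ lt =
  trans (cong (𝟙 (isCompᵇ γ) *_) (trans (∑-cong-All (All.map (λ {w} → vanish w) (qsh-sum (replicate i 1) γ)))
                                         (∑-zero (qsh (replicate i 1) γ) (λ _ → refl))))
        (ℚP.*-zeroʳ (𝟙 (isCompᵇ γ)))
  where
  vanish : ∀ w → sum w ≡ sum (replicate i 1) ℕ.+ sum γ → ⟦ x ⟧ w ≡ 0ℚ
  vanish w e = ⟦⟧-vanishes-above-degBound x w
    (ℕP.<-≤-trans lt (subst (i ℕ.≤_) (sym (trans e (cong (ℕ._+ sum γ) (sum-replicate-1 i)))) (ℕP.m≤m+n i (sum γ))))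

⟦𝔹⟧ : ∀ m x γ → ⟦ 𝔹 (suc m) x ⟧ γ ≡ 𝔹ˢ (suc m) ⟦ x ⟧ γ
⟦𝔹⟧ m x γ = trans (⟦sumN⟧ (map term (upTo (suc D))) γ) (trans (∑-map term (upTo (suc D)) (λ y → ⟦ y ⟧ γ)) (by-head γ))
  where
  D = degBound x
  term : ℕ → NSym
  term i = scale (sgn i) (Hmul (suc m ℕ.+ i) (perp1 i x))
  ⟦term⟧ : ∀ i γ → ⟦ term i ⟧ γ ≡ sgn i * Hˢ (suc (m ℕ.+ i)) (M⊥ (replicate i 1) ⟦ x ⟧) γ
  ⟦term⟧ i γ = trans (⟦scale⟧ (sgn i) (Hmul (suc (m ℕ.+ i)) (perp1 i x)) γ)
                     (cong (sgn i *_) (trans (⟦Hmul⟧ (m ℕ.+ i) (perp1 i x) γ) (Hˢ-perp γ)))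
    where
    Hˢ-perp : ∀ γ → Hˢ (suc (m ℕ.+ i)) ⟦ perp1 i x ⟧ γ ≡ Hˢ (suc (m ℕ.+ i)) (M⊥ (replicate i 1) ⟦ x ⟧) γ
    Hˢ-perp []      = refl
    Hˢ-perp (k ∷ γ) = cong (δℕ (suc (m ℕ.+ i)) k *_) (⟦perp1⟧ i x γ)
  by-head : ∀ γ → ∑[ i ← upTo (suc D) ] ⟦ term i ⟧ γ ≡ 𝔹ˢ (suc m) ⟦ x ⟧ γ
  by-head []      = ∑-zero (upTo (suc D)) (λ i → trans (⟦term⟧ i []) (ℚP.*-zeroʳ (sgn i)))
  by-head (k ∷ γ) = trans
    (∑-cong (upTo (suc D)) (λ i → trans (⟦term⟧ i (k ∷ γ))
      (solve 3 (λ s a b → s :* (a :* b) := a :* (s :* b)) refl (sgn i) (δℕ (suc (m ℕ.+ i)) k) (M⊥ (replicate i 1) ⟦ x ⟧ γ))))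
    (∑-upTo-δℕ-+ (suc D) (suc m) k (𝔹-term ⟦ x ⟧ γ) (λ i D<i →
      trans (cong (sgn i *_) (M⊥-vanishes-above-degBound x i γ D<i)) (ℚP.*-zeroʳ (sgn i))))

-- QSym as a bialgebra: the Leibniz rule for M_u^⊥

Series² : Set
Series² = List ℕ × List ℕ → ℚ

-- Φ ∘ Δ for the deconcatenation coproduct Δ
Δ* : Series² → Series
Δ* Φ w = ∑ (splits w) Φ

-- Φ applied to the quasi-shuffle product of u₁ ⊗ u₂ and v₁ ⊗ v₂ in QSym ⊗ QSym
qsh² : Series² → List ℕ × List ℕ → List ℕ × List ℕ → ℚ
qsh² Φ (u₁ , u₂) (v₁ , v₂) = ∑[ w₁ ← qsh u₁ v₁ ] ∑[ w₂ ← qsh u₂ v₂ ] Φ (w₁ , w₂)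

qsh²-[]ʳ : ∀ Φ u₁ u₂ v₂ → qsh² Φ (u₁ , u₂) ([] , v₂) ≡ ∑[ w₂ ← qsh u₂ v₂ ] Φ (u₁ , w₂)
qsh²-[]ʳ Φ u₁ u₂ v₂ = ∑-qsh-[] u₁ (λ w₁ → ∑[ w₂ ← qsh u₂ v₂ ] Φ (w₁ , w₂))

∑-qsh-Δ*-∷ : ∀ a u b v Φ → ∑ (qsh (a ∷ u) (b ∷ v)) (Δ* Φ) ≡
  (∑[ w ← qsh (a ∷ u) (b ∷ v) ] Φ ([] , w)) + (∑ (qsh u (b ∷ v)) (Δ* (shiftˡ a Φ)) +
    (∑ (qsh (a ∷ u) v) (Δ* (shiftˡ b Φ)) + ∑ (qsh u v) (Δ* (shiftˡ (a ℕ.+ b) Φ))))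
∑-qsh-Δ*-∷ a u b v Φ = begin
  ∑ (qsh (a ∷ u) (b ∷ v)) (Δ* Φ)
    ≡⟨ ∑-qsh-∷ a u b v (Δ* Φ) ⟩
  ∑ (qsh u (b ∷ v)) (Δ* Φ ∘ (a ∷_)) + (∑ (qsh (a ∷ u) v) (Δ* Φ ∘ (b ∷_)) + ∑ (qsh u v) (Δ* Φ ∘ (c ∷_)))
    ≡⟨ cong₂ _+_ (peel a (qsh u (b ∷ v))) (cong₂ _+_ (peel b (qsh (a ∷ u) v)) (peel c (qsh u v))) ⟩
  (x₀ + x) + ((y₀ + y) + (z₀ + z))
    ≡⟨ solve 6 (λ x₀ x y₀ y z₀ z → (x₀ :+ x) :+ ((y₀ :+ y) :+ (z₀ :+ z)) := (x₀ :+ (y₀ :+ z₀)) :+ (x :+ (y :+ z)))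
         refl x₀ x y₀ y z₀ z ⟩
  (x₀ + (y₀ + z₀)) + (x + (y + z))
    ≡⟨ cong (_+ (x + (y + z))) (sym (∑-qsh-∷ a u b v (λ w → Φ ([] , w)))) ⟩
  (∑[ w ← qsh (a ∷ u) (b ∷ v) ] Φ ([] , w)) + (x + (y + z)) ∎
  where
  c = a ℕ.+ b
  x₀ = ∑[ w ← qsh u (b ∷ v) ] Φ ([] , a ∷ w)
  y₀ = ∑[ w ← qsh (a ∷ u) v ] Φ ([] , b ∷ w)
  z₀ = ∑[ w ← qsh u v ] Φ ([] , c ∷ w)
  x = ∑ (qsh u (b ∷ v)) (Δ* (shiftˡ a Φ))
  y = ∑ (qsh (a ∷ u) v) (Δ* (shiftˡ b Φ))
  z = ∑ (qsh u v) (Δ* (shiftˡ c Φ))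
  peel : ∀ d ws → ∑ ws (Δ* Φ ∘ (d ∷_)) ≡ (∑[ w ← ws ] Φ ([] , d ∷ w)) + ∑ ws (Δ* (shiftˡ d Φ))
  peel d ws = trans (∑-cong ws (λ w → ∑-splits-∷ d w Φ)) (∑-+ ws _ _)

-- Φ applied to Δ(M_u) ⧢ Δ(M_v)
Δ⧢Δ : Series² → List ℕ → List ℕ → ℚ
Δ⧢Δ Φ u v = ∑[ p ← splits u ] ∑[ q ← splits v ] qsh² Φ p q

Δ⧢Δ-∷ : ∀ a u b v Φ → Δ⧢Δ Φ (a ∷ u) (b ∷ v) ≡
  (∑[ w ← qsh (a ∷ u) (b ∷ v) ] Φ ([] , w)) +
    (Δ⧢Δ (shiftˡ a Φ) u (b ∷ v) + (Δ⧢Δ (shiftˡ b Φ) (a ∷ u) v + Δ⧢Δ (shiftˡ (a ℕ.+ b) Φ) u v))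
Δ⧢Δ-∷ a u b v Φ = begin
  Δ⧢Δ Φ (a ∷ u) (b ∷ v)
    ≡⟨ ∑-splits-∷ a u (λ p → ∑ (splits (b ∷ v)) (qsh² Φ p)) ⟩
  ∑ (splits (b ∷ v)) (qsh² Φ ([] , a ∷ u)) + ∑ (splits u) (λ (p₁ , p₂) → ∑ (splits (b ∷ v)) (qsh² Φ (a ∷ p₁ , p₂)))
    ≡⟨ cong₂ _+_ (∑-splits-∷ b v (qsh² Φ ([] , a ∷ u)))
         (trans (∑-cong (splits u) (λ (p₁ , p₂) → ∑-splits-∷ b v (qsh² Φ (a ∷ p₁ , p₂))))
                (∑-+ (splits u) (λ (p₁ , p₂) → qsh² Φ (a ∷ p₁ , p₂) ([] , b ∷ v)) (λ p → ∑ (splits v) (pq p)))) ⟩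
  (qsh² Φ ([] , a ∷ u) ([] , b ∷ v) + q₀) + (p₀ + (∑[ p ← splits u ] ∑[ q ← splits v ] pq p q))
    ≡⟨ cong₂ _+_ (cong (_+ q₀) (ℚP.+-identityʳ Φ₀)) (cong (p₀ +_) split-first-parts) ⟩
  (Φ₀ + q₀) + (p₀ + (pq₁′ + (pq₂′ + pq₃′)))
    ≡⟨ solve 6 (λ x q₀ p₀ r₁ r₂ r₃ → (x :+ q₀) :+ (p₀ :+ (r₁ :+ (r₂ :+ r₃))) := x :+ ((p₀ :+ r₁) :+ ((q₀ :+ r₂) :+ r₃)))
         refl Φ₀ q₀ p₀ pq₁′ pq₂′ pq₃′ ⟩
  Φ₀ + ((p₀ + pq₁′) + ((q₀ + pq₂′) + pq₃′))
    ≡⟨ cong (Φ₀ +_) (cong₂ _+_ (sym shiftˡ-a) (cong (_+ pq₃′) (sym (∑-splits-∷ a u (λ p → ∑ (splits v) (qsh² (shiftˡ b Φ) p)))))) ⟩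
  Φ₀ + (Δ⧢Δ (shiftˡ a Φ) u (b ∷ v) + (Δ⧢Δ (shiftˡ b Φ) (a ∷ u) v + Δ⧢Δ (shiftˡ c Φ) u v)) ∎
  where
  c = a ℕ.+ b
  Φ₀ = ∑[ w ← qsh (a ∷ u) (b ∷ v) ] Φ ([] , w)
  pq pq₁ pq₂ pq₃ : List ℕ × List ℕ → List ℕ × List ℕ → ℚ
  pq (p₁ , p₂) (q₁ , q₂) = qsh² Φ (a ∷ p₁ , p₂) (b ∷ q₁ , q₂)
  pq₁ p (q₁ , q₂) = qsh² (shiftˡ a Φ) p (b ∷ q₁ , q₂)
  pq₂ (p₁ , p₂) q = qsh² (shiftˡ b Φ) (a ∷ p₁ , p₂) q
  pq₃ p q = qsh² (shiftˡ c Φ) p q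
  pq₁′ = ∑[ p ← splits u ] ∑ (splits v) (pq₁ p)
  pq₂′ = ∑[ p ← splits u ] ∑ (splits v) (pq₂ p)
  pq₃′ = ∑[ p ← splits u ] ∑ (splits v) (pq₃ p)
  q₀ = ∑ (splits v) (λ (q₁ , q₂) → qsh² Φ ([] , a ∷ u) (b ∷ q₁ , q₂))
  p₀ = ∑ (splits u) (λ (p₁ , p₂) → qsh² Φ (a ∷ p₁ , p₂) ([] , b ∷ v))
  split-first-parts : (∑[ p ← splits u ] ∑[ q ← splits v ] pq p q) ≡ pq₁′ + (pq₂′ + pq₃′)
  split-first-parts = begin
    (∑[ p ← splits u ] ∑[ q ← splits v ] pq p q)
      ≡⟨ ∑-cong (splits u) (λ (p₁ , p₂) → ∑-cong (splits v) (λ (q₁ , q₂) →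
           ∑-qsh-∷ a p₁ b q₁ (λ w₁ → ∑[ w₂ ← qsh p₂ q₂ ] Φ (w₁ , w₂)))) ⟩
    (∑[ p ← splits u ] ∑[ q ← splits v ] (pq₁ p q + (pq₂ p q + pq₃ p q)))
      ≡⟨ ∑∑-+ (splits u) (splits v) pq₁ (λ p q → pq₂ p q + pq₃ p q) ⟩
    pq₁′ + (∑[ p ← splits u ] ∑[ q ← splits v ] (pq₂ p q + pq₃ p q))
      ≡⟨ cong (pq₁′ +_) (∑∑-+ (splits u) (splits v) pq₂ pq₃) ⟩
    pq₁′ + (pq₂′ + pq₃′) ∎
  shiftˡ-a : Δ⧢Δ (shiftˡ a Φ) u (b ∷ v) ≡ p₀ + pq₁′
  shiftˡ-a = begin
    Δ⧢Δ (shiftˡ a Φ) u (b ∷ v)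
      ≡⟨ ∑-cong (splits u) (λ p → ∑-splits-∷ b v (qsh² (shiftˡ a Φ) p)) ⟩
    (∑[ p ← splits u ] (qsh² (shiftˡ a Φ) p ([] , b ∷ v) + ∑ (splits v) (pq₁ p)))
      ≡⟨ ∑-+ (splits u) (λ p → qsh² (shiftˡ a Φ) p ([] , b ∷ v)) (λ p → ∑ (splits v) (pq₁ p)) ⟩
    (∑[ p ← splits u ] qsh² (shiftˡ a Φ) p ([] , b ∷ v)) + pq₁′
      ≡⟨ cong (_+ pq₁′) (∑-cong (splits u) (λ (p₁ , p₂) →
           trans (qsh²-[]ʳ (shiftˡ a Φ) p₁ p₂ (b ∷ v)) (sym (qsh²-[]ʳ Φ (a ∷ p₁) p₂ (b ∷ v))))) ⟩
    p₀ + pq₁′ ∎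

Δ*-qsh : ∀ u v Φ → ∑ (qsh u v) (Δ* Φ) ≡ Δ⧢Δ Φ u v
Δ*-qsh []      v       Φ = cong (_+ 0ℚ) (∑-cong (splits v) (λ q →
  sym (trans (ℚP.+-identityʳ (Φ q + 0ℚ)) (ℚP.+-identityʳ (Φ q)))))
Δ*-qsh (a ∷ u) []      Φ = trans (ℚP.+-identityʳ (Δ* Φ (a ∷ u))) (sym (∑-cong (splits (a ∷ u)) (λ (p₁ , p₂) →
  trans (ℚP.+-identityʳ _) (trans (qsh²-[]ʳ Φ p₁ p₂ []) (∑-qsh-[] p₂ (λ w₂ → Φ (p₁ , w₂)))))))
Δ*-qsh (a ∷ u) (b ∷ v) Φ = begin
  ∑ (qsh (a ∷ u) (b ∷ v)) (Δ* Φ)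
    ≡⟨ ∑-qsh-Δ*-∷ a u b v Φ ⟩
  _ ≡⟨ cong ((∑[ w ← qsh (a ∷ u) (b ∷ v) ] Φ ([] , w)) +_) (cong₂ _+_ (Δ*-qsh u (b ∷ v) (shiftˡ a Φ))
                     (cong₂ _+_ (Δ*-qsh (a ∷ u) v (shiftˡ b Φ)) (Δ*-qsh u v (shiftˡ (a ℕ.+ b) Φ)))) ⟩
  _ ≡⟨ sym (Δ⧢Δ-∷ a u b v Φ) ⟩
  Δ⧢Δ Φ (a ∷ u) (b ∷ v) ∎

M⊥-⋆ : ∀ u F G γ → M⊥ u (F ⋆ G) γ ≡
  ∑ (splits u) (λ (u₁ , u₂) → ∑ (splits γ) (λ (γ₁ , γ₂) → M⊥ u₁ F γ₁ * M⊥ u₂ G γ₂))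
M⊥-⋆ u F G γ = begin
  𝟙 (isCompᵇ γ) * ∑ (qsh u γ) (Δ* Φ)
    ≡⟨ cong (𝟙 (isCompᵇ γ) *_) (Δ*-qsh u γ Φ) ⟩
  𝟙 (isCompᵇ γ) * Δ⧢Δ Φ u γ
    ≡⟨ ∑-*ˡ (splits u) (𝟙 (isCompᵇ γ)) _ ⟩
  ∑[ p ← splits u ] 𝟙 (isCompᵇ γ) * (∑[ q ← splits γ ] qsh² Φ p q)
    ≡⟨ ∑-cong (splits u) (λ (u₁ , u₂) → trans (∑-*ˡ (splits γ) (𝟙 (isCompᵇ γ)) (qsh² Φ (u₁ , u₂)))
         (∑-splits-cong γ (factor u₁ u₂))) ⟩
  ∑ (splits u) (λ (u₁ , u₂) → ∑ (splits γ) (λ (γ₁ , γ₂) → M⊥ u₁ F γ₁ * M⊥ u₂ G γ₂)) ∎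
  where
  Φ : Series²
  Φ (w₁ , w₂) = F w₁ * G w₂
  factor : ∀ u₁ u₂ γ₁ γ₂ → γ₁ ++ γ₂ ≡ γ → 𝟙 (isCompᵇ γ) * qsh² Φ (u₁ , u₂) (γ₁ , γ₂) ≡ M⊥ u₁ F γ₁ * M⊥ u₂ G γ₂
  factor u₁ u₂ γ₁ γ₂ refl = begin
    𝟙 (isCompᵇ (γ₁ ++ γ₂)) * qsh² Φ (u₁ , u₂) (γ₁ , γ₂)
      ≡⟨ cong₂ _*_ (𝟙-isComp-++ γ₁ γ₂) (sym (∑*∑ (qsh u₁ γ₁) (qsh u₂ γ₂) F G)) ⟩
    𝟙 (isCompᵇ γ₁) * 𝟙 (isCompᵇ γ₂) * (∑ (qsh u₁ γ₁) F * ∑ (qsh u₂ γ₂) G)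
      ≡⟨ solve 4 (λ a b x y → a :* b :* (x :* y) := a :* x :* (b :* y)) refl
           (𝟙 (isCompᵇ γ₁)) (𝟙 (isCompᵇ γ₂)) (∑ (qsh u₁ γ₁) F) (∑ (qsh u₂ γ₂) G) ⟩
    M⊥ u₁ F γ₁ * M⊥ u₂ G γ₂ ∎

-- The elementary functions E_s = 𝔖_{1^s}

-- The coefficient of H_γ in the elementary function E_s = Σ_{γ ⊨ s} (−1)^(s − ℓ(γ)) H_γ.
eCoeff : ℕ → Series
eCoeff s γ = 𝟙 (isCompᵇ γ) * (δℕ (sum γ) s * χ γ)

M⊥-eCoeff : ∀ s u γ → T (isCompᵇ u) →
            M⊥ u (eCoeff s) γ ≡ 𝟙 (isCompᵇ γ) * (δℕ (sum u ℕ.+ sum γ) s * (χ u * χ γ))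
M⊥-eCoeff s u γ cu with isCompᵇ γ in eq
... | false = trans (ℚP.*-zeroˡ (∑ (qsh u γ) (eCoeff s))) (sym (ℚP.*-zeroˡ (δℕ (sum u ℕ.+ sum γ) s * (χ u * χ γ))))
... | true  = cong (1ℚ *_) (begin
  ∑ (qsh u γ) (eCoeff s)
    ≡⟨ ∑-cong-All (All.zipWith (λ {w} (e , cw) → on-support w e cw) (qsh-sum u γ , qsh-isComp u γ cu (subst T (sym eq) tt))) ⟩
  ∑[ w ← qsh u γ ] δℕ (sum u ℕ.+ sum γ) s * χ w
    ≡⟨ sym (∑-*ˡ (qsh u γ) (δℕ (sum u ℕ.+ sum γ) s) χ) ⟩
  δℕ (sum u ℕ.+ sum γ) s * ∑ (qsh u γ) χ
    ≡⟨ cong (δℕ (sum u ℕ.+ sum γ) s *_) (χ-qsh u γ) ⟩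
  δℕ (sum u ℕ.+ sum γ) s * (χ u * χ γ) ∎)
  where
  on-support : ∀ w → sum w ≡ sum u ℕ.+ sum γ → T (isCompᵇ w) → eCoeff s w ≡ δℕ (sum u ℕ.+ sum γ) s * χ w
  on-support w e cw = trans (cong₂ _*_ (𝟙-T cw) (cong (λ n → δℕ n s * χ w) e)) (ℚP.*-identityˡ _)

M⊥-[]-eCoeff : ∀ s γ → M⊥ [] (eCoeff s) γ ≡ eCoeff s γ
M⊥-[]-eCoeff s γ = trans (M⊥-eCoeff s [] γ tt) (cong (λ x → 𝟙 (isCompᵇ γ) * (δℕ (sum γ) s * x)) (ℚP.*-identityˡ (χ γ)))

M⊥-1∷-eCoeff : ∀ s u γ → T (isCompᵇ u) → M⊥ (1 ∷ u) (eCoeff (suc s)) γ ≡ M⊥ u (eCoeff s) γ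
M⊥-1∷-eCoeff s u γ cu = begin
  M⊥ (1 ∷ u) (eCoeff (suc s)) γ
    ≡⟨ M⊥-eCoeff (suc s) (1 ∷ u) γ cu ⟩
  𝟙 (isCompᵇ γ) * (δℕ (sum u ℕ.+ sum γ) s * (1ℚ * χ u * χ γ))
    ≡⟨ cong (λ x → 𝟙 (isCompᵇ γ) * (δℕ (sum u ℕ.+ sum γ) s * (x * χ γ))) (ℚP.*-identityˡ (χ u)) ⟩
  𝟙 (isCompᵇ γ) * (δℕ (sum u ℕ.+ sum γ) s * (χ u * χ γ))
    ≡⟨ sym (M⊥-eCoeff s u γ cu) ⟩
  M⊥ u (eCoeff s) γ ∎

E : ℕ → Series
E s = ⟦ 𝔖 (replicate s 1) ⟧

E≗eCoeff : ∀ s γ → E s γ ≡ eCoeff s γ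
E≗eCoeff zero    []          = refl
E≗eCoeff zero    (zero ∷ γ)  = sym (ℚP.*-zeroˡ (δℕ (sum γ) 0 * χ (0 ∷ γ)))
E≗eCoeff zero    (suc g ∷ γ) =
  sym (trans (cong (𝟙 (isCompᵇ γ) *_) (ℚP.*-zeroˡ (χ (suc g ∷ γ)))) (ℚP.*-zeroʳ (𝟙 (isCompᵇ γ))))
E≗eCoeff (suc s) γ           = trans (⟦𝔹⟧ 0 (𝔖 (replicate s 1)) γ) (by-head γ)
  where
  by-head : ∀ γ → 𝔹ˢ 1 (E s) γ ≡ eCoeff (suc s) γ
  by-head []          = refl
  by-head (zero ∷ γ)  = sym (ℚP.*-zeroˡ (δℕ (sum γ) (suc s) * χ (0 ∷ γ)))
  by-head (suc j ∷ γ) = begin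
    sgn j * M⊥ (replicate j 1) (E s) γ
      ≡⟨ cong (sgn j *_) (trans (M⊥-cong (replicate j 1) (E≗eCoeff s) γ) (M⊥-eCoeff s (replicate j 1) γ (isComp-replicate-1 j))) ⟩
    sgn j * (𝟙 (isCompᵇ γ) * (δℕ (sum (replicate j 1) ℕ.+ sum γ) s * (χ (replicate j 1) * χ γ)))
      ≡⟨ cong₂ (λ n x → sgn j * (𝟙 (isCompᵇ γ) * (δℕ (n ℕ.+ sum γ) s * (x * χ γ)))) (sum-replicate-1 j) (χ-replicate-1 j) ⟩
    sgn j * (𝟙 (isCompᵇ γ) * (δℕ (j ℕ.+ sum γ) s * (1ℚ * χ γ)))
      ≡⟨ solve 4 (λ σ c d x → σ :* (c :* (d :* (con 1ℚ :* x))) := c :* (d :* ((:- (:- σ)) :* x))) refl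
           (sgn j) (𝟙 (isCompᵇ γ)) (δℕ (j ℕ.+ sum γ) s) (χ γ) ⟩
    eCoeff (suc s) (suc j ∷ γ) ∎

-- Commuting 𝔹_m past E_{s+1}

𝔹-term-⋆-eCoeff : ∀ k F s γ →
  ∑ (splits γ) (λ (γ₁ , γ₂) → 𝔹-term F γ₁ k * eCoeff (suc s) γ₂)
    ≡ 𝔹-term (F ⋆ eCoeff (suc s)) γ k + atDiff 1 k (𝔹-term (F ⋆ eCoeff s) γ)
𝔹-term-⋆-eCoeff zero F s γ = begin
  ∑ (splits γ) (λ (γ₁ , γ₂) → 1ℚ * M⊥ [] F γ₁ * eCoeff (suc s) γ₂)
    ≡⟨ ∑-cong (splits γ) (λ (γ₁ , γ₂) → cong₂ _*_ (ℚP.*-identityˡ (M⊥ [] F γ₁)) (sym (M⊥-[]-eCoeff (suc s) γ₂))) ⟩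
  ∑ (splits γ) (λ (γ₁ , γ₂) → M⊥ [] F γ₁ * M⊥ [] (eCoeff (suc s)) γ₂)
    ≡⟨ sym (trans (M⊥-⋆ [] F (eCoeff (suc s)) γ) (ℚP.+-identityʳ (((M⊥ [] F) ⋆ (M⊥ [] (eCoeff (suc s)))) γ))) ⟩
  M⊥ [] (F ⋆ eCoeff (suc s)) γ
    ≡⟨ sym (trans (ℚP.+-identityʳ _) (ℚP.*-identityˡ (M⊥ [] (F ⋆ eCoeff (suc s)) γ))) ⟩
  1ℚ * M⊥ [] (F ⋆ eCoeff (suc s)) γ + 0ℚ ∎
𝔹-term-⋆-eCoeff (suc j) F s γ = begin
  ∑ (splits γ) (λ (γ₁ , γ₂) → sgn (suc j) * M⊥ (1 ∷ 1ʲ) F γ₁ * eCoeff (suc s) γ₂)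
    ≡⟨ trans (∑-cong (splits γ) (λ (γ₁ , γ₂) → ℚP.*-assoc (sgn (suc j)) _ _)) (sym (∑-*ˡ (splits γ) (sgn (suc j)) _)) ⟩
  sgn (suc j) * peeled
    ≡⟨ solve 3 (λ σ a b → (:- σ) :* a := (:- σ) :* (a :+ b) :+ σ :* b) refl (sgn j) peeled rest ⟩
  sgn (suc j) * (peeled + rest) + sgn j * rest
    ≡⟨ cong₂ _+_ (cong (sgn (suc j) *_) (sym M⊥-⋆-eCoeff-suc)) (cong (sgn j *_) (sym (M⊥-⋆ 1ʲ F (eCoeff s) γ))) ⟩
  sgn (suc j) * M⊥ (1 ∷ 1ʲ) (F ⋆ eCoeff (suc s)) γ + sgn j * M⊥ 1ʲ (F ⋆ eCoeff s) γ ∎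
  where
  1ʲ = replicate j 1
  peeled rest : ℚ
  peeled = ∑ (splits γ) (λ (γ₁ , γ₂) → M⊥ (1 ∷ 1ʲ) F γ₁ * eCoeff (suc s) γ₂)
  rest = ∑ (splits 1ʲ) (λ (u₁ , u₂) → ∑ (splits γ) (λ (γ₁ , γ₂) → M⊥ u₁ F γ₁ * M⊥ u₂ (eCoeff s) γ₂))
  -- Leibniz rule for M_{1^(j+1)}^⊥: every summand in which some 1 acts on E_{s+1} lowers it to E_s.
  M⊥-⋆-eCoeff-suc : M⊥ (1 ∷ 1ʲ) (F ⋆ eCoeff (suc s)) γ ≡ peeled + rest
  M⊥-⋆-eCoeff-suc = begin
    M⊥ (1 ∷ 1ʲ) (F ⋆ eCoeff (suc s)) γ
      ≡⟨ M⊥-⋆ (1 ∷ 1ʲ) F (eCoeff (suc s)) γ ⟩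
    _ ≡⟨ ∑-splits-replicate j 1 (λ (u₁ , u₂) → ∑ (splits γ) (λ (γ₁ , γ₂) → M⊥ u₁ F γ₁ * M⊥ u₂ (eCoeff (suc s)) γ₂)) ⟩
    _ ≡⟨ cong₂ _+_
           (∑-cong (splits γ) (λ (γ₁ , γ₂) → cong (M⊥ (1 ∷ 1ʲ) F γ₁ *_) (M⊥-[]-eCoeff (suc s) γ₂)))
           (∑-splits-cong 1ʲ (λ u₁ u₂ u₁u₂≡1ʲ → ∑-cong (splits γ) (λ (γ₁ , γ₂) → cong (M⊥ u₁ F γ₁ *_)
             (M⊥-1∷-eCoeff s u₂ γ₂ (isComp-++ʳ u₁ u₂ (subst (T ∘ isCompᵇ) (sym u₁u₂≡1ʲ) (isComp-replicate-1 j))))))) ⟩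
    peeled + rest ∎

atDiff-𝔹-term-⋆-eCoeff : ∀ m k F s γ →
  ∑ (splits γ) (λ (γ₁ , γ₂) → atDiff m k (𝔹-term F γ₁) * eCoeff (suc s) γ₂)
    ≡ atDiff m k (𝔹-term (F ⋆ eCoeff (suc s)) γ) + atDiff (suc m) k (𝔹-term (F ⋆ eCoeff s) γ)
atDiff-𝔹-term-⋆-eCoeff zero    k       F s γ = 𝔹-term-⋆-eCoeff k F s γ
atDiff-𝔹-term-⋆-eCoeff (suc m) zero    F s γ =
  trans (∑-zero (splits γ) (λ (_ , γ₂) → ℚP.*-zeroˡ (eCoeff (suc s) γ₂))) (sym (ℚP.+-identityˡ 0ℚ))
atDiff-𝔹-term-⋆-eCoeff (suc m) (suc k) F s γ = atDiff-𝔹-term-⋆-eCoeff m k F s γ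

𝔹ˢ-⋆-eCoeff : ∀ m F s γ → (𝔹ˢ m F ⋆ eCoeff (suc s)) γ ≡ 𝔹ˢ m (F ⋆ eCoeff (suc s)) γ + 𝔹ˢ (suc m) (F ⋆ eCoeff s) γ
𝔹ˢ-⋆-eCoeff m F s []      = trans (ℚP.+-identityʳ _) (trans (ℚP.*-zeroˡ (eCoeff (suc s) [])) (sym (ℚP.+-identityˡ 0ℚ)))
𝔹ˢ-⋆-eCoeff m F s (k ∷ γ) = begin
  (𝔹ˢ m F ⋆ eCoeff (suc s)) (k ∷ γ)
    ≡⟨ ⋆-∷ (𝔹ˢ m F) (eCoeff (suc s)) k γ ⟩
  0ℚ * eCoeff (suc s) (k ∷ γ) + ((𝔹ˢ m F ∘ (k ∷_)) ⋆ eCoeff (suc s)) γ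
    ≡⟨ trans (cong (_+ ((𝔹ˢ m F ∘ (k ∷_)) ⋆ eCoeff (suc s)) γ) (ℚP.*-zeroˡ (eCoeff (suc s) (k ∷ γ)))) (ℚP.+-identityˡ _) ⟩
  ((𝔹ˢ m F ∘ (k ∷_)) ⋆ eCoeff (suc s)) γ
    ≡⟨ atDiff-𝔹-term-⋆-eCoeff m k F s γ ⟩
  𝔹ˢ m (F ⋆ eCoeff (suc s)) (k ∷ γ) + 𝔹ˢ (suc m) (F ⋆ eCoeff s) (k ∷ γ) ∎

-- The index set of the Pieri rule

admissible⇒sum≤ : ∀ α β → T (admissibleᵇ α β) → sum α ℕ.≤ sum β
admissible⇒sum≤ []          β       _  = ℕ.z≤n
admissible⇒sum≤ (zero ∷ α)  []      t  = admissible⇒sum≤ α [] t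
admissible⇒sum≤ (a ∷ α)     (b ∷ β) t with Equivalence.to T-∧ t
... | a≤b , t′ = ℕP.+-mono-≤ (ℕP.≤ᵇ⇒≤ a b a≤b) (admissible⇒sum≤ α β (proj₂ (Equivalence.to T-∧ t′)))

𝟙-admissible-∷ : ∀ a i α β →
  𝟙 (admissibleᵇ (suc a ∷ α) (suc i ∷ β)) ≡ (δℕ a i + δℕ (suc a) i) * 𝟙 (admissibleᵇ α β)
𝟙-admissible-∷ zero    zero          α β = sym (ℚP.*-identityˡ (𝟙 (admissibleᵇ α β)))
𝟙-admissible-∷ zero    (suc zero)    α β = sym (ℚP.*-identityˡ (𝟙 (admissibleᵇ α β)))
𝟙-admissible-∷ zero    (suc (suc i)) α β = sym (ℚP.*-zeroˡ (𝟙 (admissibleᵇ α β)))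
𝟙-admissible-∷ (suc a) zero          α β = sym (ℚP.*-zeroˡ (𝟙 (admissibleᵇ α β)))
𝟙-admissible-∷ (suc a) (suc i)       α β = 𝟙-admissible-∷ a i α β

𝟙-admissible-> : ∀ α β → sum β ℕ.< sum α → 𝟙 (admissibleᵇ α β) ≡ 0ℚ
𝟙-admissible-> α β β<α with admissibleᵇ α β in adm
... | false = refl
... | true  = ⊥-elim (ℕP.<⇒≱ β<α (admissible⇒sum≤ α β (subst T (sym adm) tt)))

∑-pieriIndex-[] : ∀ s (g : Series) → ∑ (pieriIndex [] s) g ≡ g (replicate s 1)
∑-pieriIndex-[] s g = trans (∑-filterᵇ (admissibleᵇ []) (compositions s) g) (only-1ˢ s g)
  where
  only-1ˢ : ∀ s (g : Series) → ∑[ β ← compositions s ] 𝟙 (admissibleᵇ [] β) * g β ≡ g (replicate s 1)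
  only-1ˢ zero    g = trans (ℚP.+-identityʳ _) (ℚP.*-identityˡ (g []))
  only-1ˢ (suc s) g = begin
    ∑[ β ← comps1 s ] 𝟙 (admissibleᵇ [] β) * g β
      ≡⟨ ∑-comps1 s (λ β → 𝟙 (admissibleᵇ [] β) * g β) ⟩
    ∑[ i ← upTo (suc s) ] ∑[ β ← compositions (s ℕ.∸ i) ] 𝟙 (admissibleᵇ [] (suc i ∷ β)) * g (suc i ∷ β)
      ≡⟨ ∑-upTo-suc s (λ i → ∑[ β ← compositions (s ℕ.∸ i) ] 𝟙 (admissibleᵇ [] (suc i ∷ β)) * g (suc i ∷ β)) ⟩
    (∑[ β ← compositions s ] 𝟙 (admissibleᵇ [] β) * g (1 ∷ β))
      + (∑[ i ← upTo s ] ∑[ β ← compositions (s ℕ.∸ suc i) ] 0ℚ * g (suc (suc i) ∷ β))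
      ≡⟨ cong₂ _+_ (only-1ˢ s (g ∘ (1 ∷_)))
           (∑-zero (upTo s) (λ i → ∑-zero (compositions (s ℕ.∸ suc i)) (λ β → ℚP.*-zeroˡ (g (suc (suc i) ∷ β))))) ⟩
    g (replicate (suc s) 1) + 0ℚ
      ≡⟨ ℚP.+-identityʳ _ ⟩
    g (replicate (suc s) 1) ∎

∑-pieriIndex-∷ : ∀ a α s (g : Series) → ∑ (pieriIndex (suc a ∷ α) s) g ≡
  ∑ (pieriIndex α s) (g ∘ (suc a ∷_)) +
  𝟙 (suc a ℕ.<ᵇ suc (a ℕ.+ sum α ℕ.+ s)) *
    ∑ (filterᵇ (admissibleᵇ α) (compositions (a ℕ.+ sum α ℕ.+ s ℕ.∸ suc a))) (g ∘ (suc (suc a) ∷_))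
∑-pieriIndex-∷ a α s g = begin
  ∑ (pieriIndex (suc a ∷ α) s) g
    ≡⟨ ∑-filterᵇ (admissibleᵇ (suc a ∷ α)) (comps1 n) g ⟩
  ∑[ β ← comps1 n ] 𝟙 (admissibleᵇ (suc a ∷ α) β) * g β
    ≡⟨ ∑-comps1 n _ ⟩
  ∑[ i ← upTo (suc n) ] ∑[ β ← compositions (n ℕ.∸ i) ] 𝟙 (admissibleᵇ (suc a ∷ α) (suc i ∷ β)) * g (suc i ∷ β)
    ≡⟨ ∑-cong (upTo (suc n)) first-part-a-or-a+1 ⟩
  ∑[ i ← upTo (suc n) ] (δℕ a i * rest i + δℕ (suc a) i * rest i)
    ≡⟨ ∑-+ (upTo (suc n)) (λ i → δℕ a i * rest i) (λ i → δℕ (suc a) i * rest i) ⟩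
  (∑[ i ← upTo (suc n) ] δℕ a i * rest i) + (∑[ i ← upTo (suc n) ] δℕ (suc a) i * rest i)
    ≡⟨ cong₂ _+_ (∑-upTo-δℕ (suc n) a rest) (∑-upTo-δℕ (suc n) (suc a) rest) ⟩
  𝟙 (a ℕ.<ᵇ suc n) * rest a + 𝟙 (suc a ℕ.<ᵇ suc n) * rest (suc a)
    ≡⟨ cong (_+ 𝟙 (suc a ℕ.<ᵇ suc n) * rest (suc a)) (trans (cong (_* rest a) (𝟙-T a<1+n)) (ℚP.*-identityˡ (rest a))) ⟩
  rest a + 𝟙 (suc a ℕ.<ᵇ suc n) * rest (suc a)
    ≡⟨ cong (λ m → ∑ (filterᵇ (admissibleᵇ α) (compositions m)) (g ∘ (suc a ∷_)) + 𝟙 (suc a ℕ.<ᵇ suc n) * rest (suc a)) n∸a ⟩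
  ∑ (pieriIndex α s) (g ∘ (suc a ∷_)) + 𝟙 (suc a ℕ.<ᵇ suc n) * rest (suc a) ∎
  where
  n = a ℕ.+ sum α ℕ.+ s
  rest : ℕ → ℚ
  rest i = ∑ (filterᵇ (admissibleᵇ α) (compositions (n ℕ.∸ i))) (g ∘ (suc i ∷_))
  first-part-a-or-a+1 : ∀ i → ∑[ β ← compositions (n ℕ.∸ i) ] 𝟙 (admissibleᵇ (suc a ∷ α) (suc i ∷ β)) * g (suc i ∷ β)
                              ≡ δℕ a i * rest i + δℕ (suc a) i * rest i
  first-part-a-or-a+1 i = begin
    ∑[ β ← compositions (n ℕ.∸ i) ] 𝟙 (admissibleᵇ (suc a ∷ α) (suc i ∷ β)) * g (suc i ∷ β)
      ≡⟨ ∑-cong (compositions (n ℕ.∸ i)) (λ β → trans (cong (_* g (suc i ∷ β)) (𝟙-admissible-∷ a i α β))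
                                                    (ℚP.*-assoc (δℕ a i + δℕ (suc a) i) (𝟙 (admissibleᵇ α β)) (g (suc i ∷ β)))) ⟩
    ∑[ β ← compositions (n ℕ.∸ i) ] (δℕ a i + δℕ (suc a) i) * (𝟙 (admissibleᵇ α β) * g (suc i ∷ β))
      ≡⟨ sym (∑-*ˡ (compositions (n ℕ.∸ i)) (δℕ a i + δℕ (suc a) i) _) ⟩
    (δℕ a i + δℕ (suc a) i) * (∑[ β ← compositions (n ℕ.∸ i) ] 𝟙 (admissibleᵇ α β) * g (suc i ∷ β))
      ≡⟨ cong ((δℕ a i + δℕ (suc a) i) *_) (sym (∑-filterᵇ (admissibleᵇ α) (compositions (n ℕ.∸ i)) (g ∘ (suc i ∷_)))) ⟩
    (δℕ a i + δℕ (suc a) i) * rest i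
      ≡⟨ ℚP.*-distribʳ-+ (rest i) (δℕ a i) (δℕ (suc a) i) ⟩
    δℕ a i * rest i + δℕ (suc a) i * rest i ∎
  a<1+n : T (a ℕ.<ᵇ suc n)
  a<1+n = ℕP.<⇒<ᵇ (ℕ.s≤s (ℕP.≤-trans (ℕP.m≤m+n a (sum α)) (ℕP.m≤m+n (a ℕ.+ sum α) s)))
  n∸a : n ℕ.∸ a ≡ sum α ℕ.+ s
  n∸a = trans (cong (ℕ._∸ a) (ℕP.+-assoc a (sum α) s)) (ℕP.m+n∸m≡n a (sum α ℕ.+ s))

∑-pieriIndex-∷-suc : ∀ a α s (g : Series) → ∑ (pieriIndex (suc a ∷ α) (suc s)) g ≡
  ∑ (pieriIndex α (suc s)) (g ∘ (suc a ∷_)) + ∑ (pieriIndex α s) (g ∘ (suc (suc a) ∷_))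
∑-pieriIndex-∷-suc a α s g = trans (∑-pieriIndex-∷ a α (suc s) g) (cong (∑ (pieriIndex α (suc s)) (g ∘ (suc a ∷_)) +_) (begin
  𝟙 (suc a ℕ.<ᵇ suc n) * ∑ (filterᵇ (admissibleᵇ α) (compositions (n ℕ.∸ suc a))) h
    ≡⟨ trans (cong (_* rest) (𝟙-T (ℕP.<⇒<ᵇ (ℕ.s≤s (subst (suc a ℕ.≤_) (sym n≡) (ℕP.m≤m+n (suc a) (sum α ℕ.+ s)))))))
             (ℚP.*-identityˡ rest) ⟩
  rest
    ≡⟨ cong (λ m → ∑ (filterᵇ (admissibleᵇ α) (compositions m)) h) n∸a+1 ⟩
  ∑ (pieriIndex α s) h ∎))
  where
  n = a ℕ.+ sum α ℕ.+ suc s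
  h = g ∘ (suc (suc a) ∷_)
  rest = ∑ (filterᵇ (admissibleᵇ α) (compositions (n ℕ.∸ suc a))) h
  n≡ : n ≡ suc a ℕ.+ (sum α ℕ.+ s)
  n≡ = trans (ℕP.+-suc (a ℕ.+ sum α) s) (cong suc (ℕP.+-assoc a (sum α) s))
  n∸a+1 : n ℕ.∸ suc a ≡ sum α ℕ.+ s
  n∸a+1 = trans (cong (ℕ._∸ suc a) n≡) (ℕP.m+n∸m≡n (suc a) (sum α ℕ.+ s))

∑-pieriIndex-∷-zero : ∀ a α (g : Series) → ∑ (pieriIndex (suc a ∷ α) 0) g ≡ ∑ (pieriIndex α 0) (g ∘ (suc a ∷_))
∑-pieriIndex-∷-zero a α g = trans (∑-pieriIndex-∷ a α 0 g)
  (trans (cong (∑ (pieriIndex α 0) (g ∘ (suc a ∷_)) +_) no-first-part-a+2) (ℚP.+-identityʳ _))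
  where
  n = a ℕ.+ sum α ℕ.+ 0
  h = g ∘ (suc (suc a) ∷_)
  rest = ∑ (filterᵇ (admissibleᵇ α) (compositions (n ℕ.∸ suc a))) h
  -- A composition of n − (a + 1) = |α| − 1 is too small to be admissible for α.
  no-first-part-a+2 : 𝟙 (suc a ℕ.<ᵇ suc n) * rest ≡ 0ℚ
  no-first-part-a+2 with suc a ℕ.<ᵇ suc n in guard
  ... | false = ℚP.*-zeroˡ rest
  ... | true  = trans (ℚP.*-identityˡ rest) (trans (∑-filterᵇ (admissibleᵇ α) (compositions (n ℕ.∸ suc a)) h)
      (trans (∑-cong-All (All.map (λ {β} → too-small β) (compositions-sum (n ℕ.∸ suc a))))
             (∑-zero (compositions (n ℕ.∸ suc a)) (λ _ → refl))))
    where
    a<n : suc a ℕ.≤ n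
    a<n = ℕP.<ᵇ⇒< a n (subst T (sym guard) tt)
    too-small : ∀ β → sum β ≡ n ℕ.∸ suc a → 𝟙 (admissibleᵇ α β) * h β ≡ 0ℚ
    too-small β e = trans (cong (_* h β) (𝟙-admissible-> α β (ℕP.≤-reflexive (ℕP.+-cancelʳ-≡ a (suc (sum β)) (sum α) size))))
                          (ℚP.*-zeroˡ (h β))
      where
      size : suc (sum β) ℕ.+ a ≡ sum α ℕ.+ a
      size = begin
        suc (sum β) ℕ.+ a          ≡⟨ sym (ℕP.+-suc (sum β) a) ⟩
        sum β ℕ.+ suc a            ≡⟨ cong (ℕ._+ suc a) e ⟩
        n ℕ.∸ suc a ℕ.+ suc a      ≡⟨ ℕP.m∸n+n≡m a<n ⟩
        a ℕ.+ sum α ℕ.+ 0          ≡⟨ trans (ℕP.+-identityʳ _) (ℕP.+-comm a (sum α)) ⟩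
        sum α ℕ.+ a                ∎

𝔹ˢ-∑𝔖 : ∀ a (L : List (List ℕ)) {F} → (∀ w → F w ≡ ∑[ β ← L ] ⟦ 𝔖 β ⟧ w) →
        ∀ γ → 𝔹ˢ (suc a) F γ ≡ ∑[ β ← L ] ⟦ 𝔖 (suc a ∷ β) ⟧ γ
𝔹ˢ-∑𝔖 a L e γ = begin
  𝔹ˢ (suc a) _ γ                           ≡⟨ 𝔹ˢ-cong (suc a) e γ ⟩
  𝔹ˢ (suc a) (λ w → ∑[ β ← L ] ⟦ 𝔖 β ⟧ w) γ ≡⟨ 𝔹ˢ-∑ (suc a) L (λ β → ⟦ 𝔖 β ⟧) γ ⟩
  ∑[ β ← L ] 𝔹ˢ (suc a) ⟦ 𝔖 β ⟧ γ          ≡⟨ ∑-cong L (λ β → sym (⟦𝔹⟧ a (𝔖 β) γ)) ⟩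
  ∑[ β ← L ] ⟦ 𝔖 (suc a ∷ β) ⟧ γ           ∎

pieri-⋆-eCoeff : ∀ α → IsComposition α → ∀ s γ → (⟦ 𝔖 α ⟧ ⋆ eCoeff s) γ ≡ ∑[ β ← pieriIndex α s ] ⟦ 𝔖 β ⟧ γ
pieri-⋆-eCoeff []          _              s       γ = begin
  (⟦ oneN ⟧ ⋆ eCoeff s) γ    ≡⟨ ⟦oneN⟧-⋆ (eCoeff s) γ ⟩
  eCoeff s γ                 ≡⟨ sym (E≗eCoeff s γ) ⟩
  ⟦ 𝔖 (replicate s 1) ⟧ γ    ≡⟨ sym (∑-pieriIndex-[] s (λ β → ⟦ 𝔖 β ⟧ γ)) ⟩
  ∑[ β ← pieriIndex [] s ] ⟦ 𝔖 β ⟧ γ ∎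
pieri-⋆-eCoeff (suc a ∷ α) (_ ∷ α-comp) zero    γ = begin
  (⟦ 𝔖 (suc a ∷ α) ⟧ ⋆ eCoeff 0) γ            ≡⟨ ⋆-eCoeff-0 ⟦ 𝔖 (suc a ∷ α) ⟧ γ ⟩
  ⟦ 𝔖 (suc a ∷ α) ⟧ γ                         ≡⟨ ⟦𝔹⟧ a (𝔖 α) γ ⟩
  𝔹ˢ (suc a) ⟦ 𝔖 α ⟧ γ                        ≡⟨ 𝔹ˢ-∑𝔖 a (pieriIndex α 0) pieri-α γ ⟩
  ∑[ β ← pieriIndex α 0 ] ⟦ 𝔖 (suc a ∷ β) ⟧ γ ≡⟨ sym (∑-pieriIndex-∷-zero a α (λ β → ⟦ 𝔖 β ⟧ γ)) ⟩
  ∑[ β ← pieriIndex (suc a ∷ α) 0 ] ⟦ 𝔖 β ⟧ γ ∎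
  where
  ⋆-eCoeff-0 : ∀ F γ → (F ⋆ eCoeff 0) γ ≡ F γ
  ⋆-eCoeff-0 F γ = trans (⋆-congʳ F (λ w → sym (E≗eCoeff 0 w)) γ) (⋆-⟦oneN⟧ F γ)
  pieri-α : ∀ w → ⟦ 𝔖 α ⟧ w ≡ ∑[ β ← pieriIndex α 0 ] ⟦ 𝔖 β ⟧ w
  pieri-α w = trans (sym (⋆-eCoeff-0 ⟦ 𝔖 α ⟧ w)) (pieri-⋆-eCoeff α α-comp 0 w)
pieri-⋆-eCoeff (suc a ∷ α) (_ ∷ α-comp) (suc s) γ = begin
  (⟦ 𝔖 (suc a ∷ α) ⟧ ⋆ eCoeff (suc s)) γ
    ≡⟨ ⋆-congˡ (eCoeff (suc s)) (⟦𝔹⟧ a (𝔖 α)) γ ⟩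
  (𝔹ˢ (suc a) ⟦ 𝔖 α ⟧ ⋆ eCoeff (suc s)) γ
    ≡⟨ 𝔹ˢ-⋆-eCoeff (suc a) ⟦ 𝔖 α ⟧ s γ ⟩
  𝔹ˢ (suc a) (⟦ 𝔖 α ⟧ ⋆ eCoeff (suc s)) γ + 𝔹ˢ (suc (suc a)) (⟦ 𝔖 α ⟧ ⋆ eCoeff s) γ
    ≡⟨ cong₂ _+_ (𝔹ˢ-∑𝔖 a (pieriIndex α (suc s)) (pieri-⋆-eCoeff α α-comp (suc s)) γ)
                 (𝔹ˢ-∑𝔖 (suc a) (pieriIndex α s) (pieri-⋆-eCoeff α α-comp s) γ) ⟩
  (∑[ β ← pieriIndex α (suc s) ] ⟦ 𝔖 (suc a ∷ β) ⟧ γ) + (∑[ β ← pieriIndex α s ] ⟦ 𝔖 (suc (suc a) ∷ β) ⟧ γ)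
    ≡⟨ sym (∑-pieriIndex-∷-suc a α s (λ β → ⟦ 𝔖 β ⟧ γ)) ⟩
  ∑[ β ← pieriIndex (suc a ∷ α) (suc s) ] ⟦ 𝔖 β ⟧ γ ∎

proposition3p32 : (α : List ℕ) → IsComposition α → (s : ℕ) →
    𝔖 α ·N 𝔖 (replicate s 1) ≈N sumN (map 𝔖 (pieriIndex α s))
proposition3p32 α α-comp s γ = begin
  coeff (𝔖 α ·N 𝔖 (replicate s 1)) γ        ≡⟨ coeff≡⟦⟧ (𝔖 α ·N 𝔖 (replicate s 1)) γ ⟩
  ⟦ 𝔖 α ·N 𝔖 (replicate s 1) ⟧ γ            ≡⟨ ⟦·N⟧ (𝔖 α) (𝔖 (replicate s 1)) γ ⟩
  (⟦ 𝔖 α ⟧ ⋆ E s) γ                         ≡⟨ ⋆-congʳ ⟦ 𝔖 α ⟧ (E≗eCoeff s) γ ⟩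
  (⟦ 𝔖 α ⟧ ⋆ eCoeff s) γ                    ≡⟨ pieri-⋆-eCoeff α α-comp s γ ⟩
  ∑[ β ← pieriIndex α s ] ⟦ 𝔖 β ⟧ γ         ≡⟨ sym (∑-map 𝔖 (pieriIndex α s) (λ x → ⟦ x ⟧ γ)) ⟩
  ∑[ x ← map 𝔖 (pieriIndex α s) ] ⟦ x ⟧ γ   ≡⟨ sym (⟦sumN⟧ (map 𝔖 (pieriIndex α s)) γ) ⟩
  ⟦ sumN (map 𝔖 (pieriIndex α s)) ⟧ γ       ≡⟨ sym (coeff≡⟦⟧ (sumN (map 𝔖 (pieriIndex α s))) γ) ⟩
  coeff (sumN (map 𝔖 (pieriIndex α s))) γ   ∎
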